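{- Let $p$ be an odd prime, $m\ge 2$ an integer with $m\mid p-1$, $q$ a prime power with $p\mid q-1$, $\theta$ a primitive $p$-th root of unity in $\mathbb{F}_q$, and $r$ a primitive root modulo $p$. Let $A_0=\{k: 1\le k\le p-1,\ k^{(p-1)/m}\equiv1\pmod p\}$, $A_j=\{r^jk \bmod p: k\in A_0\}$ for $0\le j\le m-1$, $f_j(x)=\prod_{i\in A_j}(x-\theta^i)$, and let the $m$-th residue codes of length $p$ be the $m$ cyclic codes $\mathcal{C}_j=\langle f_j(x)\rangle\subseteq\mathbb{F}_q[x]/(x^p-1)$, $j=0,\dots,m-1$. Then: (1) there exists an LCD $m$-th residue code of length $p$ if and only if $p\equiv1\pmod{2m}$; (2) the number of LCD $m$-th residue codes of length $p$ is $0$ or $m$; (3) there exists a self-orthogonal $m$-th residue code of length $p$ if and only if $p\equiv m+1\pmod{2m}$; (4) the number of self-orthogonal $m$-th residue codes of length $p$ is $0$ or $m$.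
   Context: A linear code $\mathcal{C}$ is LCD if $\mathcal{C}\cap\mathcal{C}^\perp=\{0\}$, and (in this paper's terminology) self-orthogonal if $\mathcal{C}\cap\mathcal{C}^\perp=\mathcal{C}^\perp$, i.e. $\mathcal{C}^\perp\subseteq\mathcal{C}$, where $\perp$ is the dual for the standard inner product on $\mathbb{F}_q^p$. -}

module Defs where

open import Level using (Level; _⊔_)
import Level
open import Data.Nat as ℕ using (ℕ; zero; suc; _∸_; _<_; _≤_; NonZero)
open import Data.Nat.DivMod using (_mod_)
open import Data.Nat.Primality using (Prime)
open import Data.Fin using (Fin; toℕ)
open import Data.List using (List; []; _∷_; map; filter; upTo)
open import Data.Product using (Σ; ∃; ∃-syntax; _×_; _,_)
open import Relation.Nullary using (¬_)
open import Relation.Binary.PropositionalEquality as ≡ using (_≡_)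
open import Algebra.Bundles using (CommutativeRing)
open import Function.Bundles using (Inverse)

PrimePower : ℕ → Set
PrimePower q = Σ ℕ λ l → Σ ℕ λ k → Prime l × 0 < k × q ≡ l ℕ.^ k

PrimitiveRootMod : (p : ℕ) .{{_ : NonZero p}} → ℕ → Set
PrimitiveRootMod p r =
  (r ℕ.^ (p ∸ 1)) ℕ.% p ≡ 1 ×
  (∀ k → 0 < k → k < p ∸ 1 → ¬ ((r ℕ.^ k) ℕ.% p ≡ 1))

A₀ : (p m : ℕ) .{{_ : NonZero p}} .{{_ : NonZero m}} → List ℕ
A₀ p m = filter (λ k → ((k ℕ.^ ((p ∸ 1) ℕ./ m)) ℕ.% p) ℕ.≟ 1)
                (map suc (upTo (p ∸ 1)))

A : (p m r j : ℕ) .{{_ : NonZero p}} .{{_ : NonZero m}} → List ℕ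
A p m r j = map (λ k → (r ℕ.^ j ℕ.* k) ℕ.% p) (A₀ p m)

record IsFiniteField {c ℓ} (F : CommutativeRing c ℓ) (q : ℕ) : Set (c ⊔ ℓ) where
  open CommutativeRing F
  field
    0≉1     : ¬ (0# ≈ 1#)
    inverse : ∀ x → ¬ (x ≈ 0#) → ∃[ y ] (x * y ≈ 1#)
    card    : Inverse setoid (≡.setoid (Fin q))

module CodeDefs {c ℓ} (F : CommutativeRing c ℓ) where
  open CommutativeRing F

  pow : Carrier → ℕ → Carrier
  pow x zero    = 1#
  pow x (suc n) = x * pow x n

  PrimitiveRootOfUnity : ℕ → Carrier → Set ℓ
  PrimitiveRootOfUnity p θ =
    pow θ p ≈ 1# × (∀ k → 0 < k → k < p → ¬ (pow θ k ≈ 1#))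

  -- polynomials as coefficient lists, lowest degree first
  Poly : Set c
  Poly = List Carrier

  scale : Carrier → Poly → Poly
  scale a = map (a *_)

  _⊕_ : Poly → Poly → Poly
  []       ⊕ ys       = ys
  (x ∷ xs) ⊕ []       = x ∷ xs
  (x ∷ xs) ⊕ (y ∷ ys) = (x + y) ∷ (xs ⊕ ys)

  _⊗_ : Poly → Poly → Poly
  []       ⊗ ys = []
  (x ∷ xs) ⊗ ys = scale x ys ⊕ (0# ∷ (xs ⊗ ys))

  linProd : List Carrier → Poly
  linProd []       = 1# ∷ []
  linProd (a ∷ as) = ((- a) ∷ 1# ∷ []) ⊗ linProd as

  -- words of length p  (elements of F^p ≅ F[x]/(x^p - 1))
  Word : ℕ → Set c
  Word p = Fin p → Carrier

  -- the image of a polynomial in F[x]/(x^p - 1), as a coefficient vector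
  -- (the coefficient of x^n is added to position n mod p)
  reduceFrom : (p : ℕ) .{{_ : NonZero p}} → ℕ → Poly → Word p
  reduceFrom p n []       i = 0#
  reduceFrom p n (a ∷ as) i with toℕ i ℕ.≟ toℕ (n mod p)
  ... | Relation.Nullary.yes _ = a + reduceFrom p (suc n) as i
  ... | Relation.Nullary.no  _ = reduceFrom p (suc n) as i

  reduce : (p : ℕ) .{{_ : NonZero p}} → Poly → Word p
  reduce p = reduceFrom p 0

  sumF : (n : ℕ) → (Fin n → Carrier) → Carrier
  sumF zero    f = 0#
  sumF (suc n) f = f Fin.zero + sumF n (λ i → f (Fin.suc i))
    where import Data.Fin as Fin

  -- multiplication in F[x]/(x^p - 1) on coefficient vectors
  cmul : (p : ℕ) .{{_ : NonZero p}} → Word p → Word p → Word p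
  cmul p a g i = sumF p (λ k → a k * g ((toℕ i ℕ.+ (p ∸ toℕ k)) mod p))

  inner : (p : ℕ) → Word p → Word p → Carrier
  inner p u v = sumF p (λ i → u i * v i)

  Code : ℕ → Set (Level.suc (c ⊔ ℓ))
  Code p = Word p → Set (c ⊔ ℓ)

  CyclicCode : (p : ℕ) .{{_ : NonZero p}} → Word p → Code p
  CyclicCode p g v = ∃[ a ] (∀ i → v i ≈ cmul p a g i)

  Dual : (p : ℕ) → Code p → Code p
  Dual p C v = ∀ u → C u → inner p v u ≈ 0#

  IsLCD : (p : ℕ) → Code p → Set (c ⊔ ℓ)
  IsLCD p C = ∀ v → C v → Dual p C v → ∀ i → v i ≈ 0#

  -- paper's terminology: C ∩ C^⊥ = C^⊥, i.e. C^⊥ ⊆ C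
  IsSelfOrthogonal : (p : ℕ) → Code p → Set (c ⊔ ℓ)
  IsSelfOrthogonal p C = ∀ v → Dual p C v → C v

  f : (p m r : ℕ) .{{_ : NonZero p}} .{{_ : NonZero m}} → Carrier → ℕ → Poly
  f p m r θ j = linProd (map (pow θ) (A p m r j))

  ResidueCode : (p m r : ℕ) .{{_ : NonZero p}} .{{_ : NonZero m}} → Carrier → ℕ → Code p
  ResidueCode p m r θ j = CyclicCode p (reduce p (f p m r θ j))

{-# OPTIONS --safe #-}
-- Let v̂(s) = v(θ^s) be the discrete Fourier transform of a word v; it is invertible because
-- p · 1 ≠ 0 (otherwise the Frobenius identity would force θ = 1). By the convolution theorem
-- C_j consists of the words whose transform vanishes on A_j, and pairing with the characters
-- χ_s(i) = θ^(i s), which are eigenvectors of every cyclic multiplication, shows that v ⊥ C_j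
-- forces v̂(s) = 0 whenever -s ∉ A_j. With t = (p - 1)/m we have (-1)^t ≡ 1 exactly when t is
-- even, so -A_j = A_j for even t and A_j ∩ -A_j = ∅ for odd t. In the even case C_j ∩ C_j^⊥ = 0,
-- while χ_{r^j} lies in C_j^⊥ but not in C_j; in the odd case χ_{r^j} lies in C_j ∩ C_j^⊥, and
-- inverting the transform writes every v ∈ C_j^⊥ as a combination of characters lying in C_j.
-- Finally 2m ∣ p - 1 iff t is even, and 2m ∣ p - (m + 1) iff t is odd.
module Submission where

open import Defs
open import Data.Nat as ℕ using (ℕ; zero; suc; NonZero; _<_; _≤_; s≤s; z≤n)
import Data.Nat.Properties as ℕ
open import Data.Nat.DivMod using (_mod_; m≡m%n+[m/n]*n; m%n<n; m<n⇒m%n≡m; m*n/n≡m)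
open import Data.Nat.Divisibility using (_∣_; divides; ∣⇒≤; *-monoˡ-∣; *-cancelʳ-∣)
open import Data.Nat.Primality using (Prime; euclidsLemma; prime⇒nonTrivial)
open import Data.Nat.Combinatorics using (nCn≡1; nC1≡n; nCk+nC[k+1]≡[n+1]C[k+1]; k>n⇒nCk≡0) renaming (_C_ to _𝐂_)
open import Data.Nat.Solver using (module +-*-Solver)
open +-*-Solver using (solve; _:*_; _:+_; _:=_; con)
open import Data.Fin as Fin using (Fin; toℕ; fromℕ<)
import Data.Fin.Properties as Fin
open import Data.Fin.Permutation using (Permutation; _⟨$⟩ʳ_; permutation)
open import Data.Product using (_×_; _,_; ∃; ∃-syntax; proj₁; proj₂)
open import Data.Sum using (_⊎_; inj₁; inj₂) renaming (map to ⊎-map)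
open import Function using (_∘_)
open import Data.Empty using (⊥-elim)
open import Data.List using (List; []; _∷_; map; upTo)
open import Data.List.Relation.Unary.Any as Any using (Any; here; there; any?)
import Data.List.Relation.Unary.Any.Properties as Any
open import Data.List.Membership.Propositional using (_∈_; find; lose)
open import Data.List.Membership.Propositional.Properties using (∈-filter⁺; ∈-filter⁻; ∈-map⁺; ∈-map⁻; ∈-upTo⁺; ∈-upTo⁻)
open import Relation.Nullary using (¬_; Dec; yes; no)
import Relation.Nullary.Decidable as Dec
open import Level using (0ℓ)
open import Relation.Binary using (Setoid; tri<; tri≈; tri>)
import Relation.Binary.Reasoning.Setoid
open import Relation.Binary.PropositionalEquality as ≡ using (_≡_; _≢_)
open import Function.Bundles using (Inverse; _⇔_; mk⇔)
open import Algebra.Bundles using (CommutativeRing)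

[1+k]*[1+n]C[1+k]≡[1+n]*nCk : ∀ n k → suc k ℕ.* (suc n 𝐂 suc k) ≡ suc n ℕ.* (n 𝐂 k)
[1+k]*[1+n]C[1+k]≡[1+n]*nCk zero zero = ≡.refl
[1+k]*[1+n]C[1+k]≡[1+n]*nCk zero (suc k) = begin
  suc (suc k) ℕ.* (1 𝐂 suc (suc k))  ≡⟨ ≡.cong (suc (suc k) ℕ.*_) (k>n⇒nCk≡0 {1} {suc (suc k)} (s≤s (s≤s z≤n))) ⟩
  suc (suc k) ℕ.* 0                   ≡⟨ ℕ.*-zeroʳ (suc (suc k)) ⟩
  0                                   ≡⟨ ≡.cong (1 ℕ.*_) (k>n⇒nCk≡0 {0} {suc k} (s≤s z≤n)) ⟨
  1 ℕ.* (0 𝐂 suc k)                   ∎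
  where open ≡.≡-Reasoning
[1+k]*[1+n]C[1+k]≡[1+n]*nCk (suc n) zero =
  ≡.trans (ℕ.*-identityˡ _) (≡.trans (nC1≡n (suc (suc n))) (≡.sym (ℕ.*-identityʳ (suc (suc n)))))
[1+k]*[1+n]C[1+k]≡[1+n]*nCk (suc n) (suc k) = begin
  suc (suc k) ℕ.* (suc (suc n) 𝐂 suc (suc k))
    ≡⟨ ≡.cong (suc (suc k) ℕ.*_) (nCk+nC[k+1]≡[n+1]C[k+1] (suc n) (suc k)) ⟨
  suc (suc k) ℕ.* (a ℕ.+ b)
    ≡⟨ solve 3 (λ k a b → (con 2 :+ k) :* (a :+ b) := a :+ (con 1 :+ k) :* a :+ (con 2 :+ k) :* b) ≡.refl k a b ⟩
  a ℕ.+ suc k ℕ.* a ℕ.+ suc (suc k) ℕ.* b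
    ≡⟨ ≡.cong₂ (λ u v → a ℕ.+ u ℕ.+ v) ([1+k]*[1+n]C[1+k]≡[1+n]*nCk n k) ([1+k]*[1+n]C[1+k]≡[1+n]*nCk n (suc k)) ⟩
  a ℕ.+ suc n ℕ.* (n 𝐂 k) ℕ.+ suc n ℕ.* (n 𝐂 suc k)
    ≡⟨ solve 4 (λ n a x y → a :+ (con 1 :+ n) :* x :+ (con 1 :+ n) :* y := a :+ (con 1 :+ n) :* (x :+ y)) ≡.refl n a (n 𝐂 k) (n 𝐂 suc k) ⟩
  a ℕ.+ suc n ℕ.* ((n 𝐂 k) ℕ.+ (n 𝐂 suc k))
    ≡⟨ ≡.cong (λ z → a ℕ.+ suc n ℕ.* z) (nCk+nC[k+1]≡[n+1]C[k+1] n k) ⟩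
  suc (suc n) ℕ.* a ∎
  where
  open ≡.≡-Reasoning
  a = suc n 𝐂 suc k
  b = suc n 𝐂 suc (suc k)

-- The prime p divides k · (p choose k) = p · ((p - 1) choose (k - 1)) but not k.
p∣pCk : ∀ {p} → Prime p → ∀ {k} → 0 < k → k < p → p ∣ p 𝐂 k
p∣pCk {suc n} pp {suc k} _ k<p
  with euclidsLemma (suc k) (suc n 𝐂 suc k) pp
         (divides (n 𝐂 k) (≡.trans ([1+k]*[1+n]C[1+k]≡[1+n]*nCk n k) (ℕ.*-comm (suc n) _)))
... | inj₁ p∣1+k = ⊥-elim (ℕ.<⇒≱ k<p (∣⇒≤ p∣1+k))
... | inj₂ p∣pCk = p∣pCk

[m*n]^o≡m^o*n^o : ∀ m n o → (m ℕ.* n) ℕ.^ o ≡ m ℕ.^ o ℕ.* n ℕ.^ o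
[m*n]^o≡m^o*n^o m n zero    = ≡.refl
[m*n]^o≡m^o*n^o m n (suc o) = ≡.trans (≡.cong ((m ℕ.* n) ℕ.*_) ([m*n]^o≡m^o*n^o m n o))
  (solve 4 (λ m n x y → (m :* n) :* (x :* y) := (m :* x) :* (n :* y)) ≡.refl m n (m ℕ.^ o) (n ℕ.^ o))

Even Odd : ℕ → Set
Even n = ∃ λ u → n ≡ 2 ℕ.* u
Odd  n = ∃ λ u → n ≡ suc (2 ℕ.* u)

even⊎odd : ∀ n → Even n ⊎ Odd n
even⊎odd zero = inj₁ (0 , ≡.refl)
even⊎odd (suc n) with even⊎odd n
... | inj₁ (u , n≡2u)   = inj₂ (u , ≡.cong suc n≡2u)
... | inj₂ (u , n≡1+2u) = inj₁ (suc u , ≡.trans (≡.cong suc n≡1+2u) (≡.sym (ℕ.*-suc 2 u)))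

2m∣tm⇒even : ∀ m .{{_ : NonZero m}} t → 2 ℕ.* m ∣ t ℕ.* m → Even t
2m∣tm⇒even m t 2m∣tm with *-cancelʳ-∣ m 2m∣tm
... | divides u t≡u*2 = u , ≡.trans t≡u*2 (ℕ.*-comm u 2)

even⇒2m∣tm : ∀ m {t} → Even t → 2 ℕ.* m ∣ t ℕ.* m
even⇒2m∣tm m (u , t≡2u) = *-monoˡ-∣ m (divides u (≡.trans t≡2u (ℕ.*-comm 2 u)))

p∸[m+1]≡[t∸1]*m : ∀ p m t → p ℕ.∸ 1 ≡ t ℕ.* m → p ℕ.∸ (m ℕ.+ 1) ≡ (t ℕ.∸ 1) ℕ.* m
p∸[m+1]≡[t∸1]*m p m t p∸1≡tm = begin
  p ℕ.∸ (m ℕ.+ 1)          ≡⟨ ≡.cong (p ℕ.∸_) (ℕ.+-comm m 1) ⟩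
  p ℕ.∸ (1 ℕ.+ m)          ≡⟨ ℕ.∸-+-assoc p 1 m ⟨
  p ℕ.∸ 1 ℕ.∸ m            ≡⟨ ≡.cong (ℕ._∸ m) p∸1≡tm ⟩
  t ℕ.* m ℕ.∸ m            ≡⟨ ≡.cong (t ℕ.* m ℕ.∸_) (ℕ.*-identityˡ m) ⟨
  t ℕ.* m ℕ.∸ 1 ℕ.* m      ≡⟨ ℕ.*-distribʳ-∸ m t 1 ⟨
  (t ℕ.∸ 1) ℕ.* m          ∎
  where open ≡.≡-Reasoning

p∸1≡tm⇒t≡1+[t∸1] : ∀ {p m} t → 1 < p → p ℕ.∸ 1 ≡ t ℕ.* m → t ≡ suc (t ℕ.∸ 1)
p∸1≡tm⇒t≡1+[t∸1] zero    1<p p∸1≡0 = ⊥-elim (ℕ.m<n⇒n≢0 (ℕ.m<n⇒0<n∸m 1<p) p∸1≡0)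
p∸1≡tm⇒t≡1+[t∸1] (suc _) _   _     = ≡.refl

module QuotientParity (p m t : ℕ) .{{_ : NonZero m}} (1<p : 1 < p) (p∸1≡tm : p ℕ.∸ 1 ≡ t ℕ.* m) where

  p∸[m+1]≡[t∸1]m : p ℕ.∸ (m ℕ.+ 1) ≡ (t ℕ.∸ 1) ℕ.* m
  p∸[m+1]≡[t∸1]m = p∸[m+1]≡[t∸1]*m p m t p∸1≡tm

  even-divisibility : Even t → 2 ℕ.* m ∣ p ℕ.∸ 1 × ¬ (2 ℕ.* m ∣ p ℕ.∸ (m ℕ.+ 1))
  even-divisibility t-even@(u , t≡2u) = ≡.subst (2 ℕ.* m ∣_) (≡.sym p∸1≡tm) (even⇒2m∣tm m t-even) , 2m∤
    where
    2m∤ : ¬ (2 ℕ.* m ∣ p ℕ.∸ (m ℕ.+ 1))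
    2m∤ 2m∣ with 2m∣tm⇒even m (t ℕ.∸ 1) (≡.subst (2 ℕ.* m ∣_) p∸[m+1]≡[t∸1]m 2m∣)
    ... | c , t∸1≡2c = ℕ.even≢odd u c
      (≡.trans (≡.sym t≡2u) (≡.trans (p∸1≡tm⇒t≡1+[t∸1] t 1<p p∸1≡tm) (≡.cong suc t∸1≡2c)))

  odd-divisibility : Odd t → ¬ (2 ℕ.* m ∣ p ℕ.∸ 1) × 2 ℕ.* m ∣ p ℕ.∸ (m ℕ.+ 1)
  odd-divisibility (u , t≡1+2u) =
    2m∤ , ≡.subst (2 ℕ.* m ∣_) (≡.sym p∸[m+1]≡[t∸1]m) (even⇒2m∣tm m (u , ≡.cong ℕ.pred t≡1+2u))
    where
    2m∤ : ¬ (2 ℕ.* m ∣ p ℕ.∸ 1)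
    2m∤ 2m∣ with 2m∣tm⇒even m t (≡.subst (2 ℕ.* m ∣_) p∸1≡tm 2m∣)
    ... | c , t≡2c = ℕ.even≢odd c u (≡.trans (≡.sym t≡2c) t≡1+2u)

module RingLemmas {c ℓ} (R : CommutativeRing c ℓ) where
  open CommutativeRing R
  open CodeDefs R
  open import Algebra.Properties.Ring ring public using (x∙y⁻¹≈ε⇒x≈y; x≈y⇒x∙y⁻¹≈ε; +-cancelʳ)
  open import Algebra.Properties.Semiring.Exp semiring public using (_^_; ^-homo-*; ^-assocʳ)
  open import Algebra.Properties.Semiring.Mult semiring public using (×-congˡ; ×-congʳ; ×-assoc-*; ×1-homo-*) renaming (_×_ to _·_)
  open import Algebra.Properties.CommutativeMonoid.Sum +-commutativeMonoid
    using (sum; sum-cong-≋; sum-replicate; sum-replicate-zero; ∑-distrib-+; ∑-comm; sum-permute; sum-init-last)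
  open import Algebra.Properties.Semiring.Sum semiring using (*-distribˡ-sum)
  import Algebra.Properties.CommutativeSemiring.Binomial commutativeSemiring as Binomial
  open import Relation.Binary.Reasoning.Setoid setoid

  pow≡^ : ∀ x n → pow x n ≡ x ^ n
  pow≡^ x zero    = ≡.refl
  pow≡^ x (suc n) = ≡.cong (x *_) (pow≡^ x n)

  pow-cong : ∀ {x y} n → x ≈ y → pow x n ≈ pow y n
  pow-cong zero    _   = refl
  pow-cong (suc n) x≈y = *-cong x≈y (pow-cong n x≈y)

  pow-homo-* : ∀ x m n → pow x (m ℕ.+ n) ≈ pow x m * pow x n
  pow-homo-* x m n = begin
    pow x (m ℕ.+ n)      ≡⟨ pow≡^ x (m ℕ.+ n) ⟩
    x ^ (m ℕ.+ n)        ≈⟨ ^-homo-* x m n ⟩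
    x ^ m * x ^ n        ≡⟨ ≡.cong₂ _*_ (pow≡^ x m) (pow≡^ x n) ⟨
    pow x m * pow x n    ∎

  pow-assocʳ : ∀ x m n → pow (pow x m) n ≈ pow x (m ℕ.* n)
  pow-assocʳ x m n = begin
    pow (pow x m) n    ≡⟨ ≡.trans (pow≡^ (pow x m) n) (≡.cong (_^ n) (pow≡^ x m)) ⟩
    (x ^ m) ^ n        ≈⟨ ^-assocʳ x m n ⟩
    x ^ (m ℕ.* n)      ≡⟨ pow≡^ x (m ℕ.* n) ⟨
    pow x (m ℕ.* n)    ∎

  pow-1# : ∀ n → pow 1# n ≈ 1#
  pow-1# zero    = refl
  pow-1# (suc n) = trans (*-identityˡ _) (pow-1# n)

  pow-0# : ∀ n → 0 < n → pow 0# n ≈ 0#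
  pow-0# (suc n) _ = zeroˡ _

  sumF≡sum : ∀ n f → sumF n f ≡ sum {n} f
  sumF≡sum zero    f = ≡.refl
  sumF≡sum (suc n) f = ≡.cong (f Fin.zero +_) (sumF≡sum n (λ i → f (Fin.suc i)))

  sumF-cong : ∀ n {f g : Fin n → Carrier} → (∀ i → f i ≈ g i) → sumF n f ≈ sumF n g
  sumF-cong n {f} {g} f≈g = begin
    sumF n f  ≡⟨ sumF≡sum n f ⟩
    sum f     ≈⟨ sum-cong-≋ f≈g ⟩
    sum g     ≡⟨ sumF≡sum n g ⟨
    sumF n g  ∎

  sumF-zero : ∀ n {f : Fin n → Carrier} → (∀ i → f i ≈ 0#) → sumF n f ≈ 0#
  sumF-zero n {f} f≈0 = begin
    sumF n f            ≡⟨ sumF≡sum n f ⟩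
    sum f               ≈⟨ sum-cong-≋ f≈0 ⟩
    sum {n} (λ _ → 0#)  ≈⟨ sum-replicate-zero n ⟩
    0#                  ∎

  sumF-const : ∀ n x → sumF n (λ _ → x) ≈ n · x
  sumF-const n x = trans (reflexive (sumF≡sum n _)) (sum-replicate n)

  sumF-distrib-+ : ∀ n (f g : Fin n → Carrier) → sumF n (λ i → f i + g i) ≈ sumF n f + sumF n g
  sumF-distrib-+ n f g = begin
    sumF n (λ i → f i + g i)  ≡⟨ sumF≡sum n _ ⟩
    sum (λ i → f i + g i)     ≈⟨ ∑-distrib-+ f g ⟩
    sum f + sum g             ≡⟨ ≡.cong₂ _+_ (sumF≡sum n f) (sumF≡sum n g) ⟨
    sumF n f + sumF n g       ∎

  *-distribˡ-sumF : ∀ n x (f : Fin n → Carrier) → x * sumF n f ≈ sumF n (λ i → x * f i)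
  *-distribˡ-sumF n x f = begin
    x * sumF n f              ≡⟨ ≡.cong (x *_) (sumF≡sum n f) ⟩
    x * sum f                 ≈⟨ *-distribˡ-sum x f ⟩
    sum (λ i → x * f i)       ≡⟨ sumF≡sum n _ ⟨
    sumF n (λ i → x * f i)    ∎

  *-distribʳ-sumF : ∀ n x (f : Fin n → Carrier) → sumF n f * x ≈ sumF n (λ i → f i * x)
  *-distribʳ-sumF n x f =
    trans (*-comm _ x) (trans (*-distribˡ-sumF n x f) (sumF-cong n (λ i → *-comm x (f i))))

  sumF-comm : ∀ m n (f : Fin m → Fin n → Carrier) →
              sumF m (λ i → sumF n (f i)) ≈ sumF n (λ j → sumF m (λ i → f i j))
  sumF-comm m n f = begin
    sumF m (λ i → sumF n (f i))            ≈⟨ sumF-cong m (λ i → reflexive (sumF≡sum n (f i))) ⟩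
    sumF m (λ i → sum (f i))               ≡⟨ sumF≡sum m _ ⟩
    sum (λ i → sum (f i))                  ≈⟨ ∑-comm f ⟩
    sum (λ j → sum (λ i → f i j))          ≡⟨ sumF≡sum n _ ⟨
    sumF n (λ j → sum (λ i → f i j))       ≈⟨ sumF-cong n (λ j → reflexive (sumF≡sum m (λ i → f i j))) ⟨
    sumF n (λ j → sumF m (λ i → f i j))    ∎

  sumF-permute : ∀ n (f : Fin n → Carrier) (π : Permutation n n) →
                 sumF n f ≈ sumF n (λ i → f (π ⟨$⟩ʳ i))
  sumF-permute n f π = begin
    sumF n f                     ≡⟨ sumF≡sum n f ⟩
    sum f                        ≈⟨ sum-permute f π ⟩
    sum (λ i → f (π ⟨$⟩ʳ i))     ≡⟨ sumF≡sum n _ ⟨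
    sumF n (λ i → f (π ⟨$⟩ʳ i))  ∎

  sumF-δ : ∀ n (f : Fin n → Carrier) k → (∀ i → i ≢ k → f i ≈ 0#) → sumF n f ≈ f k
  sumF-δ (suc n) f Fin.zero    f≈0 =
    trans (+-congˡ (sumF-zero n (λ i → f≈0 (Fin.suc i) (λ ())))) (+-identityʳ _)
  sumF-δ (suc n) f (Fin.suc k) f≈0 =
    trans (+-congʳ (f≈0 Fin.zero (λ ()))) (trans (+-identityˡ _)
      (sumF-δ n (λ i → f (Fin.suc i)) k (λ i i≢k → f≈0 (Fin.suc i) (i≢k ∘ Fin.suc-injective))))

  ∣⇒·≈0 : ∀ {p n} → p · 1# ≈ 0# → p ∣ n → ∀ x → n · x ≈ 0#
  ∣⇒·≈0 {p} p·1≈0 (divides k ≡.refl) x = begin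
    (k ℕ.* p) · x                ≈⟨ ×-congʳ (k ℕ.* p) (*-identityˡ x) ⟨
    (k ℕ.* p) · (1# * x)         ≈⟨ ×-assoc-* (k ℕ.* p) 1# x ⟨
    ((k ℕ.* p) · 1#) * x         ≈⟨ *-congʳ (×1-homo-* k p) ⟩
    ((k · 1#) * (p · 1#)) * x    ≈⟨ *-congʳ (*-congˡ p·1≈0) ⟩
    ((k · 1#) * 0#) * x          ≈⟨ *-congʳ (zeroʳ _) ⟩
    0# * x                       ≈⟨ zeroˡ x ⟩
    0#                           ∎

  freshmansDream : ∀ {p} → Prime p → p · 1# ≈ 0# → ∀ x y → (x + y) ^ p ≈ x ^ p + y ^ p
  freshmansDream {suc n} pp p·1≈0 x y = begin
    (x + y) ^ suc n
      ≈⟨ Binomial.theorem (suc n) x y ⟩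
    term Fin.zero + sum (λ i → term (Fin.suc i))
      ≈⟨ +-cong first (sum-init-last (λ i → term (Fin.suc i))) ⟩
    y ^ suc n + (sum (λ i → term (Fin.suc (Fin.inject₁ i))) + term (Fin.suc (Fin.fromℕ n)))
      ≈⟨ +-congˡ (+-cong (trans (reflexive (≡.sym (sumF≡sum n _))) (sumF-zero n middle)) last) ⟩
    y ^ suc n + (0# + x ^ suc n)
      ≈⟨ trans (+-congˡ (+-identityˡ _)) (+-comm _ _) ⟩
    x ^ suc n + y ^ suc n
      ∎
    where
    term = Binomial.binomialTerm x y (suc n)
    first : term Fin.zero ≈ y ^ suc n
    first = trans (+-identityʳ _) (*-identityˡ _)
    middle : ∀ i → term (Fin.suc (Fin.inject₁ i)) ≈ 0#
    middle i = ∣⇒·≈0 p·1≈0 (p∣pCk pp (s≤s z≤n)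
      (s≤s (≡.subst (_< n) (≡.sym (Fin.toℕ-inject₁ i)) (Fin.toℕ<n i)))) _
    last : term (Fin.suc (Fin.fromℕ n)) ≈ x ^ suc n
    last = begin
      term (Fin.suc (Fin.fromℕ n))
        ≡⟨ ≡.cong (λ k → (suc n 𝐂 suc k) · (x ^ suc k * y ^ (n ℕ.∸ k))) (Fin.toℕ-fromℕ n) ⟩
      (suc n 𝐂 suc n) · (x ^ suc n * y ^ (n ℕ.∸ n))  ≈⟨ ×-congˡ (nCn≡1 (suc n)) ⟩
      1 · (x ^ suc n * y ^ (n ℕ.∸ n))                ≈⟨ +-identityʳ _ ⟩
      x ^ suc n * y ^ (n ℕ.∸ n)                      ≡⟨ ≡.cong (λ k → x ^ suc n * y ^ k) (ℕ.n∸n≡0 n) ⟩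
      x ^ suc n * 1#                                 ≈⟨ *-identityʳ _ ⟩
      x ^ suc n                                      ∎

  geometricSum : ℕ → Carrier → Carrier
  geometricSum n x = sumF n (λ i → pow x (toℕ i))

  geometricSum-telescope : ∀ n x → x * geometricSum n x + 1# ≈ geometricSum n x + pow x n
  geometricSum-telescope zero    x = +-congʳ (zeroʳ x)
  geometricSum-telescope (suc n) x = begin
    x * G[1+n] + 1#                       ≈⟨ +-congʳ (*-congˡ G[1+n]≈1+xG) ⟩
    x * (1# + x * G) + 1#                 ≈⟨ +-congʳ (*-congˡ (+-comm _ _)) ⟩
    x * (x * G + 1#) + 1#                 ≈⟨ +-congʳ (*-congˡ (geometricSum-telescope n x)) ⟩
    x * (G + pow x n) + 1#                ≈⟨ +-congʳ (distribˡ _ _ _) ⟩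
    (x * G + x * pow x n) + 1#            ≈⟨ +-assoc _ _ _ ⟩
    x * G + (x * pow x n + 1#)            ≈⟨ +-congˡ (+-comm _ _) ⟩
    x * G + (1# + x * pow x n)            ≈⟨ +-assoc _ _ _ ⟨
    (x * G + 1#) + x * pow x n            ≈⟨ +-congʳ (trans (+-comm _ _) (sym G[1+n]≈1+xG)) ⟩
    G[1+n] + pow x (suc n)                ∎
    where
    G = geometricSum n x
    G[1+n] = geometricSum (suc n) x
    G[1+n]≈1+xG : G[1+n] ≈ 1# + x * G
    G[1+n]≈1+xG = +-congˡ (sym (*-distribˡ-sumF n x _))

  eval : Poly → Carrier → Carrier
  eval []       x = 0#
  eval (a ∷ as) x = a + x * eval as x

  eval-⊕ : ∀ P Q x → eval (P ⊕ Q) x ≈ eval P x + eval Q x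
  eval-⊕ []      Q       x = sym (+-identityˡ _)
  eval-⊕ (a ∷ P) []      x = sym (+-identityʳ _)
  eval-⊕ (a ∷ P) (b ∷ Q) x = begin
    (a + b) + x * eval (P ⊕ Q) x    ≈⟨ +-congˡ (*-congˡ (eval-⊕ P Q x)) ⟩
    (a + b) + x * (P[x] + Q[x])     ≈⟨ +-congˡ (distribˡ x P[x] Q[x]) ⟩
    (a + b) + (x * P[x] + x * Q[x]) ≈⟨ +-assoc _ _ _ ⟩
    a + (b + (x * P[x] + x * Q[x])) ≈⟨ +-congˡ (+-assoc _ _ _) ⟨
    a + ((b + x * P[x]) + x * Q[x]) ≈⟨ +-congˡ (+-congʳ (+-comm _ _)) ⟩
    a + ((x * P[x] + b) + x * Q[x]) ≈⟨ +-congˡ (+-assoc _ _ _) ⟩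
    a + (x * P[x] + (b + x * Q[x])) ≈⟨ +-assoc _ _ _ ⟨
    (a + x * P[x]) + (b + x * Q[x]) ∎
    where P[x] = eval P x ; Q[x] = eval Q x

  eval-scale : ∀ a P x → eval (scale a P) x ≈ a * eval P x
  eval-scale a []      x = sym (zeroʳ a)
  eval-scale a (b ∷ P) x = begin
    a * b + x * eval (scale a P) x  ≈⟨ +-congˡ (*-congˡ (eval-scale a P x)) ⟩
    a * b + x * (a * P[x])          ≈⟨ +-congˡ (trans (sym (*-assoc _ _ _)) (*-congʳ (*-comm x a))) ⟩
    a * b + (a * x) * P[x]          ≈⟨ +-congˡ (*-assoc _ _ _) ⟩
    a * b + a * (x * P[x])          ≈⟨ distribˡ a _ _ ⟨
    a * (b + x * P[x])              ∎
    where P[x] = eval P x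

  eval-⊗ : ∀ P Q x → eval (P ⊗ Q) x ≈ eval P x * eval Q x
  eval-⊗ []      Q x = sym (zeroˡ _)
  eval-⊗ (a ∷ P) Q x = begin
    eval (scale a Q ⊕ (0# ∷ (P ⊗ Q))) x             ≈⟨ eval-⊕ (scale a Q) _ x ⟩
    eval (scale a Q) x + (0# + x * eval (P ⊗ Q) x)  ≈⟨ +-cong (eval-scale a Q x) (+-identityˡ _) ⟩
    a * Q[x] + x * eval (P ⊗ Q) x                   ≈⟨ +-congˡ (*-congˡ (eval-⊗ P Q x)) ⟩
    a * Q[x] + x * (P[x] * Q[x])                    ≈⟨ +-congˡ (*-assoc _ _ _) ⟨
    a * Q[x] + (x * P[x]) * Q[x]                    ≈⟨ distribʳ Q[x] a _ ⟨
    (a + x * P[x]) * Q[x]                           ∎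
    where P[x] = eval P x ; Q[x] = eval Q x

  ∏[x-_] : List Carrier → Carrier → Carrier
  ∏[x- []     ] x = 1#
  ∏[x- a ∷ as ] x = (x - a) * ∏[x- as ] x

  eval-linProd : ∀ as x → eval (linProd as) x ≈ ∏[x- as ] x
  eval-linProd []       x = trans (+-congˡ (zeroʳ x)) (+-identityʳ _)
  eval-linProd (a ∷ as) x = begin
    eval (((- a) ∷ 1# ∷ []) ⊗ linProd as) x            ≈⟨ eval-⊗ ((- a) ∷ 1# ∷ []) (linProd as) x ⟩
    (- a + x * (1# + x * 0#)) * eval (linProd as) x   ≈⟨ *-cong x-a (eval-linProd as x) ⟩
    (x - a) * ∏[x- as ] x                              ∎
    where
    x-a : - a + x * (1# + x * 0#) ≈ x - a
    x-a = trans (+-congˡ (trans (*-congˡ (trans (+-congˡ (zeroʳ x)) (+-identityʳ _))) (*-identityʳ x))) (+-comm _ _)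

  ∏[x-]-root : ∀ {x} as → Any (x ≈_) as → ∏[x- as ] x ≈ 0#
  ∏[x-]-root (a ∷ as) (here x≈a)  = trans (*-congʳ (x≈y⇒x∙y⁻¹≈ε x≈a)) (zeroˡ _)
  ∏[x-]-root (a ∷ as) (there x∈as) = trans (*-congˡ (∏[x-]-root as x∈as)) (zeroʳ _)

module FieldLemmas {c ℓ} (F : CommutativeRing c ℓ) {q} (FF : IsFiniteField F q) where
  open CommutativeRing F
  open CodeDefs F
  open IsFiniteField FF
  open RingLemmas F
  open import Relation.Binary.Reasoning.Setoid setoid

  infix 4 _≈?_
  _≈?_ : ∀ x y → Dec (x ≈ y)
  x ≈? y with Inverse.to card x Fin.≟ Inverse.to card y
  ... | yes x↦y = yes (begin
          x                                      ≈⟨ Inverse.strictlyInverseʳ card x ⟨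
          Inverse.from card (Inverse.to card x)  ≡⟨ ≡.cong (Inverse.from card) x↦y ⟩
          Inverse.from card (Inverse.to card y)  ≈⟨ Inverse.strictlyInverseʳ card y ⟩
          y                                      ∎)
  ... | no x↦̸y = no (λ x≈y → x↦̸y (Inverse.to-cong card x≈y))

  infix 4 _≉0
  _≉0 : Carrier → Set ℓ
  x ≉0 = ¬ (x ≈ 0#)

  inv : ∀ x → x ≉0 → Carrier
  inv x x≉0 = proj₁ (inverse x x≉0)

  inverseʳ : ∀ x (x≉0 : x ≉0) → x * inv x x≉0 ≈ 1#
  inverseʳ x x≉0 = proj₂ (inverse x x≉0)

  inverseˡ : ∀ x (x≉0 : x ≉0) → inv x x≉0 * x ≈ 1#
  inverseˡ x x≉0 = trans (*-comm _ x) (inverseʳ x x≉0)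

  *-cancelˡ : ∀ {x y z} → x ≉0 → x * y ≈ x * z → y ≈ z
  *-cancelˡ {x} {y} {z} x≉0 xy≈xz = begin
    y                ≈⟨ *-identityˡ y ⟨
    1# * y           ≈⟨ *-congʳ (inverseˡ x x≉0) ⟨
    (x⁻¹ * x) * y    ≈⟨ *-assoc _ _ _ ⟩
    x⁻¹ * (x * y)    ≈⟨ *-congˡ xy≈xz ⟩
    x⁻¹ * (x * z)    ≈⟨ *-assoc _ _ _ ⟨
    (x⁻¹ * x) * z    ≈⟨ *-congʳ (inverseˡ x x≉0) ⟩
    1# * z           ≈⟨ *-identityˡ z ⟩
    z                ∎
    where x⁻¹ = inv x x≉0

  *-zero-cancelˡ : ∀ {x y} → x ≉0 → x * y ≈ 0# → y ≈ 0#
  *-zero-cancelˡ {x} x≉0 xy≈0 = *-cancelˡ x≉0 (trans xy≈0 (sym (zeroʳ x)))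

  *-≉0 : ∀ {x y} → x ≉0 → y ≉0 → x * y ≉0
  *-≉0 x≉0 y≉0 xy≈0 = y≉0 (*-zero-cancelˡ x≉0 xy≈0)

  pow-≉0 : ∀ {x} n → x ≉0 → pow x n ≉0
  pow-≉0 zero    x≉0 1≈0 = 0≉1 (sym 1≈0)
  pow-≉0 (suc n) x≉0     = *-≉0 x≉0 (pow-≉0 n x≉0)

  ∏[x-]-≉0 : ∀ {x} as → ¬ Any (x ≈_) as → ∏[x- as ] x ≉0
  ∏[x-]-≉0 []       _      1≈0 = 0≉1 (sym 1≈0)
  ∏[x-]-≉0 (a ∷ as) x∉a∷as =
    *-≉0 (λ x-a≈0 → x∉a∷as (here (x∙y⁻¹≈ε⇒x≈y _ _ x-a≈0))) (∏[x-]-≉0 as (x∉a∷as ∘ there))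

  -- If p · 1 = 0 then (θ - 1 + 1)^p = (θ - 1)^p + 1 by the Frobenius identity, so θ^p = 1 forces θ = 1.
  primitiveRoot⇒p·1≉0 : ∀ {p θ} → Prime p → PrimitiveRootOfUnity p θ → p · 1# ≉0
  primitiveRoot⇒p·1≉0 {p} {θ} pp (θ^p≈1 , θ^k≉1) p·1≈0 = pow-≉0 p θ-1≉0 (+-cancelʳ 1# _ _ (begin
    pow (θ - 1#) p + 1#          ≡⟨ ≡.cong (_+ 1#) (pow≡^ (θ - 1#) p) ⟩
    (θ - 1#) ^ p + 1#            ≈⟨ +-congˡ (trans (sym (reflexive (pow≡^ 1# p))) (pow-1# p)) ⟨
    (θ - 1#) ^ p + 1# ^ p        ≈⟨ freshmansDream pp p·1≈0 (θ - 1#) 1# ⟨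
    ((θ - 1#) + 1#) ^ p          ≈⟨ ^-congˡ p θ-1+1≈θ ⟩
    θ ^ p                        ≡⟨ pow≡^ θ p ⟨
    pow θ p                      ≈⟨ θ^p≈1 ⟩
    1#                           ≈⟨ +-identityˡ 1# ⟨
    0# + 1#                      ∎))
    where
    open import Algebra.Properties.Semiring.Exp semiring using (^-congˡ)
    θ-1+1≈θ : (θ - 1#) + 1# ≈ θ
    θ-1+1≈θ = trans (+-assoc _ _ _) (trans (+-congˡ (-‿inverseˡ 1#)) (+-identityʳ θ))
    θ-1≉0 : θ - 1# ≉0
    θ-1≉0 θ-1≈0 = θ^k≉1 1 (s≤s z≤n) (ℕ.nonTrivial⇒n>1 p {{prime⇒nonTrivial pp}})
                    (trans (*-identityʳ θ) (x∙y⁻¹≈ε⇒x≈y θ 1# θ-1≈0))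

module Fourier {c ℓ} (F : CommutativeRing c ℓ) {q} (FF : IsFiniteField F q)
               (p : ℕ) .{{_ : NonZero p}} (pp : Prime p) (θ : CommutativeRing.Carrier F)
               (prim : CodeDefs.PrimitiveRootOfUnity F p θ) where
  open CommutativeRing F
  open CodeDefs F
  open IsFiniteField FF
  open RingLemmas F
  open FieldLemmas F FF
  open import Relation.Binary.Reasoning.Setoid setoid

  infix 8 θ^_
  θ^_ : ℕ → Carrier
  θ^ a = pow θ a

  θ^-homo : ∀ a b → θ^ (a ℕ.+ b) ≈ θ^ a * θ^ b
  θ^-homo = pow-homo-* θ

  θ^-≉0 : ∀ a → θ^ a ≉0
  θ^-≉0 a = pow-≉0 a θ≉0
    where
    θ≉0 : θ ≉0
    θ≉0 θ≈0 = 0≉1 (begin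
      0#        ≈⟨ pow-0# p (ℕ.>-nonZero⁻¹ p) ⟨
      pow 0# p  ≈⟨ pow-cong p θ≈0 ⟨
      pow θ p   ≈⟨ proj₁ prim ⟩
      1#        ∎)

  θ^[kp]≈1 : ∀ k → θ^ (k ℕ.* p) ≈ 1#
  θ^[kp]≈1 k = begin
    θ^ (k ℕ.* p)     ≡⟨ ≡.cong θ^_ (ℕ.*-comm k p) ⟩
    θ^ (p ℕ.* k)     ≈⟨ pow-assocʳ θ p k ⟨
    pow (θ^ p) k     ≈⟨ pow-cong k (proj₁ prim) ⟩
    pow 1# k         ≈⟨ pow-1# k ⟩
    1#               ∎

  θ^-mod : ∀ a → θ^ a ≈ θ^ (a ℕ.% p)
  θ^-mod a = begin
    θ^ a                                  ≡⟨ ≡.cong θ^_ (m≡m%n+[m/n]*n a p) ⟩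
    θ^ (a ℕ.% p ℕ.+ a ℕ./ p ℕ.* p)        ≈⟨ θ^-homo (a ℕ.% p) _ ⟩
    θ^ (a ℕ.% p) * θ^ (a ℕ./ p ℕ.* p)     ≈⟨ *-congˡ (θ^[kp]≈1 (a ℕ./ p)) ⟩
    θ^ (a ℕ.% p) * 1#                     ≈⟨ *-identityʳ _ ⟩
    θ^ (a ℕ.% p)                          ∎

  θ^-≉-< : ∀ {x y} → x < y → y < p → ¬ (θ^ y ≈ θ^ x)
  θ^-≉-< {x} {y} x<y y<p θ^y≈θ^x = proj₂ prim (y ℕ.∸ x) (ℕ.m<n⇒0<n∸m x<y)
    (ℕ.≤-<-trans (ℕ.m∸n≤m y x) y<p)
    (*-cancelˡ (θ^-≉0 x) (begin
      θ^ x * θ^ (y ℕ.∸ x)   ≈⟨ θ^-homo x _ ⟨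
      θ^ (x ℕ.+ (y ℕ.∸ x))  ≡⟨ ≡.cong θ^_ (ℕ.m+[n∸m]≡n (ℕ.<⇒≤ x<y)) ⟩
      θ^ y                  ≈⟨ θ^y≈θ^x ⟩
      θ^ x                  ≈⟨ *-identityʳ _ ⟨
      θ^ x * 1#             ∎))

  θ^-injective-< : ∀ {a b} → a < p → b < p → θ^ a ≈ θ^ b → a ≡ b
  θ^-injective-< {a} {b} a<p b<p θ^a≈θ^b with ℕ.<-cmp a b
  ... | tri< a<b _ _ = ⊥-elim (θ^-≉-< a<b b<p (sym θ^a≈θ^b))
  ... | tri≈ _ a≡b _ = a≡b
  ... | tri> _ _ b<a = ⊥-elim (θ^-≉-< b<a a<p θ^a≈θ^b)

  -- Congruence modulo p, encoded as equality of powers of θ (θ has order exactly p):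
  -- compatibility with + and * is then inherited from the field.
  infix 4 _≡ₚ_
  record _≡ₚ_ (a b : ℕ) : Set ℓ where
    constructor mk≡ₚ
    field θ^≈ : θ^ a ≈ θ^ b
  open _≡ₚ_ public

  ≡ₚ-refl : ∀ {a} → a ≡ₚ a
  ≡ₚ-refl = mk≡ₚ refl

  ≡ₚ-sym : ∀ {a b} → a ≡ₚ b → b ≡ₚ a
  ≡ₚ-sym (mk≡ₚ e) = mk≡ₚ (sym e)

  ≡ₚ-trans : ∀ {a b c} → a ≡ₚ b → b ≡ₚ c → a ≡ₚ c
  ≡ₚ-trans (mk≡ₚ e) (mk≡ₚ f) = mk≡ₚ (trans e f)

  ≡⇒≡ₚ : ∀ {a b} → a ≡ b → a ≡ₚ b
  ≡⇒≡ₚ ≡.refl = ≡ₚ-refl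

  ≡ₚ-setoid : Setoid 0ℓ ℓ
  ≡ₚ-setoid = record
    { _≈_ = _≡ₚ_
    ; isEquivalence = record { refl = ≡ₚ-refl ; sym = ≡ₚ-sym ; trans = ≡ₚ-trans }
    }

  module ≡ₚ-Reasoning = Relation.Binary.Reasoning.Setoid ≡ₚ-setoid

  ≡ₚ-+ : ∀ {a b c d} → a ≡ₚ b → c ≡ₚ d → a ℕ.+ c ≡ₚ b ℕ.+ d
  ≡ₚ-+ {a} {b} {c} {d} (mk≡ₚ a≡b) (mk≡ₚ c≡d) =
    mk≡ₚ (trans (θ^-homo a c) (trans (*-cong a≡b c≡d) (sym (θ^-homo b d))))

  ≡ₚ-*ʳ : ∀ {a b} c → a ≡ₚ b → a ℕ.* c ≡ₚ b ℕ.* c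
  ≡ₚ-*ʳ {a} {b} c (mk≡ₚ a≡b) =
    mk≡ₚ (trans (sym (pow-assocʳ θ a c)) (trans (pow-cong c a≡b) (pow-assocʳ θ b c)))

  ≡ₚ-*ˡ : ∀ {a b} c → a ≡ₚ b → c ℕ.* a ≡ₚ c ℕ.* b
  ≡ₚ-*ˡ {a} {b} c a≡b =
    ≡ₚ-trans (≡⇒≡ₚ (ℕ.*-comm c a)) (≡ₚ-trans (≡ₚ-*ʳ c a≡b) (≡⇒≡ₚ (ℕ.*-comm b c)))

  ≡ₚ-* : ∀ {a b c d} → a ≡ₚ b → c ≡ₚ d → a ℕ.* c ≡ₚ b ℕ.* d
  ≡ₚ-* {b = b} {c = c} a≡b c≡d = ≡ₚ-trans (≡ₚ-*ʳ c a≡b) (≡ₚ-*ˡ b c≡d)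

  ≡ₚ-^ : ∀ {a b} n → a ≡ₚ b → a ℕ.^ n ≡ₚ b ℕ.^ n
  ≡ₚ-^ zero    a≡b = ≡ₚ-refl
  ≡ₚ-^ (suc n) a≡b = ≡ₚ-* a≡b (≡ₚ-^ n a≡b)

  ≡ₚ-+-cancelʳ : ∀ {a b} c → a ℕ.+ c ≡ₚ b ℕ.+ c → a ≡ₚ b
  ≡ₚ-+-cancelʳ {a} {b} c (mk≡ₚ e) = mk≡ₚ (*-cancelˡ (θ^-≉0 c)
    (trans (*-comm _ _) (trans (sym (θ^-homo a c)) (trans e (trans (θ^-homo b c) (*-comm _ _))))))

  p≡ₚ0 : p ≡ₚ 0
  p≡ₚ0 = mk≡ₚ (proj₁ prim)

  ≡ₚ-% : ∀ a → a ≡ₚ a ℕ.% p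
  ≡ₚ-% a = mk≡ₚ (θ^-mod a)

  ≡ₚ⇒%≡ : ∀ {a b} → a ≡ₚ b → a ℕ.% p ≡ b ℕ.% p
  ≡ₚ⇒%≡ {a} {b} (mk≡ₚ e) =
    θ^-injective-< (m%n<n a p) (m%n<n b p) (trans (sym (θ^-mod a)) (trans e (θ^-mod b)))

  toℕ-≡ₚ-injective : ∀ {i j : Fin p} → toℕ i ≡ₚ toℕ j → i ≡ j
  toℕ-≡ₚ-injective (mk≡ₚ e) = Fin.toℕ-injective (θ^-injective-< (Fin.toℕ<n _) (Fin.toℕ<n _) e)

  toℕ-mod : ∀ a → toℕ (a mod p) ≡ₚ a
  toℕ-mod a = ≡ₚ-trans (≡⇒≡ₚ (Fin.toℕ-fromℕ< (m%n<n a p))) (≡ₚ-sym (≡ₚ-% a))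

  χ : ℕ → Word p
  χ s i = θ^ (toℕ i ℕ.* s)

  χ-≉0 : ∀ s → ¬ (∀ i → χ s i ≈ 0#)
  χ-≉0 s χ≈0 = 0≉1 (trans (sym (χ≈0 i₀)) (reflexive (≡.cong (λ e → θ^ (e ℕ.* s)) (Fin.toℕ-fromℕ< 0<p))))
    where
    0<p = ℕ.>-nonZero⁻¹ p
    i₀ = fromℕ< 0<p

  dft : Word p → ℕ → Carrier
  dft w s = sumF p (λ i → w i * χ s i)

  θ^[is]≈θ^s^i : ∀ i s → θ^ (i ℕ.* s) ≈ pow (θ^ s) i
  θ^[is]≈θ^s^i i s = trans (reflexive (≡.cong θ^_ (ℕ.*-comm i s))) (sym (pow-assocʳ θ s i))

  χ-cong : ∀ {s t} → s ≡ₚ t → ∀ i → χ s i ≈ χ t i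
  χ-cong {s} {t} s≡t i = θ^≈ (≡ₚ-*ˡ (toℕ i) s≡t)

  dft-congˡ : ∀ {v w} → (∀ i → v i ≈ w i) → ∀ s → dft v s ≈ dft w s
  dft-congˡ v≈w s = sumF-cong p (λ i → *-congʳ (v≈w i))

  dft-congʳ : ∀ w {s t} → s ≡ₚ t → dft w s ≈ dft w t
  dft-congʳ w s≡t = sumF-cong p (λ i → *-congˡ (χ-cong s≡t i))

  dft-scale : ∀ x w s → dft (λ i → x * w i) s ≈ x * dft w s
  dft-scale x w s = trans (sumF-cong p (λ i → *-assoc _ _ _)) (sym (*-distribˡ-sumF p x _))

  charSum : ℕ → Carrier
  charSum s = sumF p (χ s)

  charSum-≉1 : ∀ s → ¬ (θ^ s ≈ 1#) → charSum s ≈ 0#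
  charSum-≉1 s θ^s≉1 with charSum s ≈? 0#
  ... | yes S≈0 = S≈0
  ... | no  S≉0 = ⊥-elim (θ^s≉1 (*-cancelˡ S≉0 (begin
    charSum s * θ^ s    ≈⟨ *-comm _ _ ⟩
    θ^ s * charSum s    ≈⟨ *-congˡ S≈G ⟩
    θ^ s * G            ≈⟨ +-cancelʳ 1# _ _ (trans (geometricSum-telescope p (θ^ s)) (+-congˡ θ^s^p≈1)) ⟩
    G                   ≈⟨ S≈G ⟨
    charSum s           ≈⟨ *-identityʳ _ ⟨
    charSum s * 1#      ∎)))
    where
    G = geometricSum p (θ^ s)
    S≈G : charSum s ≈ G
    S≈G = sumF-cong p (λ i → θ^[is]≈θ^s^i (toℕ i) s)
    θ^s^p≈1 : pow (θ^ s) p ≈ 1#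
    θ^s^p≈1 = trans (pow-assocʳ θ s p) (θ^[kp]≈1 s)

  charSum-≈1 : ∀ s → θ^ s ≈ 1# → charSum s ≈ p · 1#
  charSum-≈1 s θ^s≈1 = trans
    (sumF-cong p (λ i → trans (θ^[is]≈θ^s^i (toℕ i) s) (trans (pow-cong (toℕ i) θ^s≈1) (pow-1# (toℕ i)))))
    (sumF-const p 1#)

  p·1≉0 : p · 1# ≉0
  p·1≉0 = primitiveRoot⇒p·1≉0 pp prim

  -- -s modulo p, written (p - 1)·s to avoid truncated subtraction.
  neg : ℕ → ℕ
  neg s = (p ℕ.∸ 1) ℕ.* s

  s+neg[s]≡ₚ0 : ∀ s → s ℕ.+ neg s ≡ₚ 0
  s+neg[s]≡ₚ0 s = ≡ₚ-trans (≡⇒≡ₚ s+[p-1]s≡ps) (≡ₚ-*ʳ s p≡ₚ0)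
    where
    s+[p-1]s≡ps : s ℕ.+ (p ℕ.∸ 1) ℕ.* s ≡ p ℕ.* s
    s+[p-1]s≡ps = ≡.cong (ℕ._* s) (ℕ.m+[n∸m]≡n (ℕ.>-nonZero⁻¹ p))

  neg-involutive : ∀ s → neg (neg s) ≡ₚ s
  neg-involutive s = ≡ₚ-+-cancelʳ (neg s) (≡ₚ-trans (≡⇒≡ₚ (ℕ.+-comm (neg (neg s)) (neg s)))
    (≡ₚ-trans (s+neg[s]≡ₚ0 (neg s)) (≡ₚ-sym (s+neg[s]≡ₚ0 s))))

  dft-inversion : ∀ v (i : Fin p) → sumF p (λ s → dft v (toℕ s) * χ (neg (toℕ i)) s) ≈ p · 1# * v i
  dft-inversion v i = begin
    sumF p (λ s → dft v (toℕ s) * θ^ (toℕ s ℕ.* -i))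
      ≈⟨ sumF-cong p (λ s → *-distribʳ-sumF p _ _) ⟩
    sumF p (λ s → sumF p (λ l → (v l * θ^ (toℕ l ℕ.* toℕ s)) * θ^ (toℕ s ℕ.* -i)))
      ≈⟨ sumF-comm p p _ ⟩
    sumF p (λ l → sumF p (λ s → (v l * θ^ (toℕ l ℕ.* toℕ s)) * θ^ (toℕ s ℕ.* -i)))
      ≈⟨ sumF-cong p (λ l → trans (sumF-cong p (λ s → collect l s)) (sym (*-distribˡ-sumF p (v l) _))) ⟩
    sumF p (λ l → v l * charSum (toℕ l ℕ.+ -i))
      ≈⟨ sumF-δ p _ i (λ l l≢i → trans (*-congˡ (charSum-≉1 _ (off-diagonal l l≢i))) (zeroʳ _)) ⟩
    v i * charSum (toℕ i ℕ.+ -i)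
      ≈⟨ *-congˡ (charSum-≈1 _ (θ^≈ (s+neg[s]≡ₚ0 (toℕ i)))) ⟩
    v i * p · 1#
      ≈⟨ *-comm _ _ ⟩
    p · 1# * v i
      ∎
    where
    -i = neg (toℕ i)
    collect : ∀ l (s : Fin p) →
      (v l * θ^ (toℕ l ℕ.* toℕ s)) * θ^ (toℕ s ℕ.* -i) ≈ v l * χ (toℕ l ℕ.+ -i) s
    collect l s = begin
      (v l * θ^ (toℕ l ℕ.* toℕ s)) * θ^ (toℕ s ℕ.* -i)  ≈⟨ *-assoc _ _ _ ⟩
      v l * (θ^ (toℕ l ℕ.* toℕ s) * θ^ (toℕ s ℕ.* -i))  ≈⟨ *-congˡ (θ^-homo (toℕ l ℕ.* toℕ s) (toℕ s ℕ.* -i)) ⟨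
      v l * θ^ (toℕ l ℕ.* toℕ s ℕ.+ toℕ s ℕ.* -i)       ≡⟨ ≡.cong (λ e → v l * θ^ e) (solve 3 (λ l s n → l :* s :+ s :* n := s :* (l :+ n)) ≡.refl (toℕ l) (toℕ s) -i) ⟩
      v l * θ^ (toℕ s ℕ.* (toℕ l ℕ.+ -i))               ∎
    off-diagonal : ∀ l → l ≢ i → ¬ (θ^ (toℕ l ℕ.+ -i) ≈ 1#)
    off-diagonal l l≢i θ^≈1 = l≢i (toℕ-≡ₚ-injective
      (≡ₚ-+-cancelʳ -i (≡ₚ-trans (mk≡ₚ θ^≈1) (≡ₚ-sym (s+neg[s]≡ₚ0 (toℕ i))))))

  dft-injective : ∀ {u v} → (∀ s → dft u s ≈ dft v s) → ∀ i → u i ≈ v i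
  dft-injective {u} {v} û≈v̂ i = *-cancelˡ p·1≉0 (begin
    p · 1# * u i                                            ≈⟨ dft-inversion u i ⟨
    sumF p (λ s → dft u (toℕ s) * χ (neg (toℕ i)) s)        ≈⟨ sumF-cong p (λ s → *-congʳ (û≈v̂ (toℕ s))) ⟩
    sumF p (λ s → dft v (toℕ s) * χ (neg (toℕ i)) s)        ≈⟨ dft-inversion v i ⟩
    p · 1# * v i                                            ∎)

  monomial : ℕ → Carrier → Word p
  monomial n a i with toℕ i ℕ.≟ toℕ (n mod p)
  ... | yes _ = a
  ... | no  _ = 0#

  reduceFrom-∷ : ∀ n a as i → reduceFrom p n (a ∷ as) i ≈ monomial n a i + reduceFrom p (suc n) as i
  reduceFrom-∷ n a as i with toℕ i ℕ.≟ toℕ (n mod p)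
  ... | yes _ = refl
  ... | no  _ = sym (+-identityˡ _)

  monomial-off : ∀ n a i → i ≢ n mod p → monomial n a i ≈ 0#
  monomial-off n a i i≢n with toℕ i ℕ.≟ toℕ (n mod p)
  ... | yes i≡n = ⊥-elim (i≢n (Fin.toℕ-injective i≡n))
  ... | no  _   = refl

  monomial-on : ∀ n a → monomial n a (n mod p) ≈ a
  monomial-on n a with toℕ (n mod p) ℕ.≟ toℕ (n mod p)
  ... | yes _ = refl
  ... | no  n≢n = ⊥-elim (n≢n ≡.refl)

  dft-monomial : ∀ n a s → dft (monomial n a) s ≈ a * θ^ (n ℕ.* s)
  dft-monomial n a s = begin
    dft (monomial n a) s                    ≈⟨ sumF-δ p _ (n mod p) (λ i i≢n → trans (*-congʳ (monomial-off n a i i≢n)) (zeroˡ _)) ⟩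
    monomial n a (n mod p) * χ s (n mod p)  ≈⟨ *-cong (monomial-on n a) (θ^≈ (≡ₚ-*ʳ s (toℕ-mod n))) ⟩
    a * θ^ (n ℕ.* s)                        ∎

  dft-reduceFrom : ∀ n P s → dft (reduceFrom p n P) s ≈ θ^ (n ℕ.* s) * eval P (θ^ s)
  dft-reduceFrom n []       s = trans (sumF-zero p (λ i → zeroˡ _)) (sym (zeroʳ _))
  dft-reduceFrom n (a ∷ as) s = begin
    dft (reduceFrom p n (a ∷ as)) s
      ≈⟨ sumF-cong p (λ i → trans (*-congʳ (reduceFrom-∷ n a as i)) (distribʳ _ _ _)) ⟩
    sumF p (λ i → monomial n a i * χ s i + reduceFrom p (suc n) as i * χ s i)
      ≈⟨ sumF-distrib-+ p _ _ ⟩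
    dft (monomial n a) s + dft (reduceFrom p (suc n) as) s
      ≈⟨ +-cong (dft-monomial n a s) (dft-reduceFrom (suc n) as s) ⟩
    a * θ^ (n ℕ.* s) + θ^ (s ℕ.+ n ℕ.* s) * eval as (θ^ s)
      ≈⟨ +-cong (*-comm _ _) (*-congʳ (trans (θ^-homo s (n ℕ.* s)) (*-comm _ _))) ⟩
    θ^ (n ℕ.* s) * a + (θ^ (n ℕ.* s) * θ^ s) * eval as (θ^ s)
      ≈⟨ trans (+-congˡ (*-assoc _ _ _)) (sym (distribˡ _ _ _)) ⟩
    θ^ (n ℕ.* s) * eval (a ∷ as) (θ^ s)
      ∎

  generator : List ℕ → Word p
  generator L = reduce p (linProd (map θ^_ L))

  dft-generator : ∀ L s → dft (generator L) s ≈ ∏[x- map θ^_ L ] (θ^ s)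
  dft-generator L s = begin
    dft (generator L) s                       ≈⟨ dft-reduceFrom 0 (linProd (map θ^_ L)) s ⟩
    1# * eval (linProd (map θ^_ L)) (θ^ s)    ≈⟨ *-identityˡ _ ⟩
    eval (linProd (map θ^_ L)) (θ^ s)         ≈⟨ eval-linProd (map θ^_ L) (θ^ s) ⟩
    ∏[x- map θ^_ L ] (θ^ s)                   ∎

  infix 4 _∈ₚ_
  _∈ₚ_ : ℕ → List ℕ → Set ℓ
  s ∈ₚ L = Any (s ≡ₚ_) L

  ∈ₚ-resp-≡ₚ : ∀ {s t L} → s ≡ₚ t → s ∈ₚ L → t ∈ₚ L
  ∈ₚ-resp-≡ₚ s≡t = Any.map (≡ₚ-trans (≡ₚ-sym s≡t))

  _∈ₚ?_ : ∀ s L → Dec (s ∈ₚ L)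
  s ∈ₚ? L = any? (λ a → Dec.map′ mk≡ₚ θ^≈ (θ^ s ≈? θ^ a)) L

  dft-generator-root : ∀ {L s} → s ∈ₚ L → dft (generator L) s ≈ 0#
  dft-generator-root {L} {s} s∈L =
    trans (dft-generator L s) (∏[x-]-root (map θ^_ L) (Any.map⁺ (Any.map θ^≈ s∈L)))

  dft-generator-≉0 : ∀ {L s} → ¬ s ∈ₚ L → dft (generator L) s ≉0
  dft-generator-≉0 {L} {s} s∉L ĝ≈0 =
    ∏[x-]-≉0 (map θ^_ L) (λ s∈L → s∉L (Any.map mk≡ₚ (Any.map⁻ s∈L))) (trans (sym (dft-generator L s)) ĝ≈0)

  shift : ℕ → Fin p → Fin p
  shift a i = (toℕ i ℕ.+ a) mod p

  shift-+ : ∀ a b i → a ℕ.+ b ≡ₚ 0 → i ℕ.+ a ℕ.+ b ≡ₚ i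
  shift-+ a b i a+b≡0 = ≡ₚ-trans (≡⇒≡ₚ (ℕ.+-assoc i a b))
    (≡ₚ-trans (≡ₚ-+ (≡ₚ-refl {i}) a+b≡0) (≡⇒≡ₚ (ℕ.+-identityʳ i)))

  toℕ-shift : ∀ a i → toℕ (shift a i) ≡ₚ toℕ i ℕ.+ a
  toℕ-shift a i = toℕ-mod (toℕ i ℕ.+ a)

  shift-inverse : ∀ {a b} → a ℕ.+ b ≡ₚ 0 → ∀ i → toℕ (shift a (shift b i)) ≡ₚ toℕ i
  shift-inverse {a} {b} a+b≡0 i =
    ≡ₚ-trans (toℕ-shift a (shift b i)) (≡ₚ-trans (≡ₚ-+ (toℕ-shift b i) ≡ₚ-refl) (shift-+ b a (toℕ i)
      (≡ₚ-trans (≡⇒≡ₚ (ℕ.+-comm b a)) a+b≡0)))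

  rotation : ∀ a b → a ℕ.+ b ≡ₚ 0 → Permutation p p
  rotation a b a+b≡0 = permutation (shift a) (shift b)
    (λ i → toℕ-≡ₚ-injective (shift-inverse a+b≡0 i))
    (λ i → toℕ-≡ₚ-injective (shift-inverse (≡ₚ-trans (≡⇒≡ₚ (ℕ.+-comm b a)) a+b≡0) i))

  dft-shift : ∀ g s (k : Fin p) → sumF p (λ i → g (shift (p ℕ.∸ toℕ k) i) * χ s i) ≈ θ^ (toℕ k ℕ.* s) * dft g s
  dft-shift g s k = begin
    sumF p (λ i → g (π ⟨$⟩ʳ i) * χ s i)              ≈⟨ sumF-cong p (λ i → *-congˡ (θ^≈ (≡ₚ-*ʳ s (i≡ₚπi+k i)))) ⟩
    sumF p (λ i → h (π ⟨$⟩ʳ i))                      ≈⟨ sumF-permute p h π ⟨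
    sumF p h                                         ≈⟨ sumF-cong p h≈θ^ks*term ⟩
    sumF p (λ j → θ^ (toℕ k ℕ.* s) * (g j * χ s j))  ≈⟨ *-distribˡ-sumF p _ _ ⟨
    θ^ (toℕ k ℕ.* s) * dft g s                       ∎
    where
    k+[p-k]≡ₚ0 : toℕ k ℕ.+ (p ℕ.∸ toℕ k) ≡ₚ 0
    k+[p-k]≡ₚ0 = ≡ₚ-trans (≡⇒≡ₚ (ℕ.m+[n∸m]≡n (ℕ.<⇒≤ (Fin.toℕ<n k)))) p≡ₚ0
    π = rotation (p ℕ.∸ toℕ k) (toℕ k) (≡ₚ-trans (≡⇒≡ₚ (ℕ.+-comm (p ℕ.∸ toℕ k) (toℕ k))) k+[p-k]≡ₚ0)
    h : Fin p → Carrier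
    h j = g j * θ^ ((toℕ j ℕ.+ toℕ k) ℕ.* s)
    i≡ₚπi+k : ∀ i → toℕ i ≡ₚ toℕ (π ⟨$⟩ʳ i) ℕ.+ toℕ k
    i≡ₚπi+k i = ≡ₚ-sym (≡ₚ-trans (≡ₚ-+ (toℕ-shift _ i) (≡ₚ-refl {toℕ k}))
      (shift-+ (p ℕ.∸ toℕ k) (toℕ k) (toℕ i) (≡ₚ-trans (≡⇒≡ₚ (ℕ.+-comm _ (toℕ k))) k+[p-k]≡ₚ0)))
    h≈θ^ks*term : ∀ j → h j ≈ θ^ (toℕ k ℕ.* s) * (g j * χ s j)
    h≈θ^ks*term j = begin
      g j * θ^ ((toℕ j ℕ.+ toℕ k) ℕ.* s)            ≡⟨ ≡.cong (λ e → g j * θ^ e) (ℕ.*-distribʳ-+ s (toℕ j) (toℕ k)) ⟩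
      g j * θ^ (toℕ j ℕ.* s ℕ.+ toℕ k ℕ.* s)        ≈⟨ *-congˡ (θ^-homo (toℕ j ℕ.* s) (toℕ k ℕ.* s)) ⟩
      g j * (χ s j * θ^ (toℕ k ℕ.* s))              ≈⟨ trans (sym (*-assoc _ _ _)) (*-comm _ _) ⟩
      θ^ (toℕ k ℕ.* s) * (g j * χ s j)              ∎

  dft-cmul : ∀ a g s → dft (cmul p a g) s ≈ dft a s * dft g s
  dft-cmul a g s = begin
    dft (cmul p a g) s
      ≈⟨ sumF-cong p (λ i → *-distribʳ-sumF p _ _) ⟩
    sumF p (λ i → sumF p (λ k → (a k * g (shift (p ℕ.∸ toℕ k) i)) * χ s i))
      ≈⟨ sumF-comm p p _ ⟩
    sumF p (λ k → sumF p (λ i → (a k * g (shift (p ℕ.∸ toℕ k) i)) * χ s i))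
      ≈⟨ sumF-cong p (λ k → trans (sumF-cong p (λ i → *-assoc _ _ _)) (sym (*-distribˡ-sumF p (a k) _))) ⟩
    sumF p (λ k → a k * sumF p (λ i → g (shift (p ℕ.∸ toℕ k) i) * χ s i))
      ≈⟨ sumF-cong p (λ k → *-congˡ (dft-shift g s k)) ⟩
    sumF p (λ k → a k * (θ^ (toℕ k ℕ.* s) * dft g s))
      ≈⟨ sumF-cong p (λ k → *-assoc _ _ _) ⟨
    sumF p (λ k → (a k * χ s k) * dft g s)
      ≈⟨ *-distribʳ-sumF p _ _ ⟨
    dft a s * dft g s
      ∎

  dft-χ : ∀ s k → dft (χ s) k ≈ charSum (s ℕ.+ k)
  dft-χ s k = sumF-cong p (λ i → trans (sym (θ^-homo (toℕ i ℕ.* s) (toℕ i ℕ.* k)))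
                                       (reflexive (≡.cong θ^_ (≡.sym (ℕ.*-distribˡ-+ (toℕ i) s k)))))

  cmul-χ : ∀ g s i → cmul p (χ s) g i ≈ dft g (neg s) * χ s i
  cmul-χ g s = dft-injective (λ k → begin
    dft (cmul p (χ s) g) k               ≈⟨ dft-cmul (χ s) g k ⟩
    dft (χ s) k * dft g k                ≈⟨ eigen k ⟩
    dft g (neg s) * dft (χ s) k          ≈⟨ dft-scale _ (χ s) k ⟨
    dft (λ i → dft g (neg s) * χ s i) k  ∎)
    where
    eigen : ∀ k → dft (χ s) k * dft g k ≈ dft g (neg s) * dft (χ s) k
    eigen k with θ^ (s ℕ.+ k) ≈? 1#
    ... | yes θ^[s+k]≈1 = trans (*-comm _ _) (*-congʳ (dft-congʳ g k≡ₚneg[s]))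
      where
      k≡ₚneg[s] : k ≡ₚ neg s
      k≡ₚneg[s] = ≡ₚ-+-cancelʳ s (≡ₚ-trans (≡⇒≡ₚ (ℕ.+-comm k s)) (≡ₚ-trans (mk≡ₚ θ^[s+k]≈1)
                    (≡ₚ-trans (≡ₚ-sym (s+neg[s]≡ₚ0 s)) (≡⇒≡ₚ (ℕ.+-comm s (neg s))))))
    ... | no θ^[s+k]≉1 = trans (*-congʳ χ̂≈0) (trans (zeroˡ _) (sym (trans (*-congˡ χ̂≈0) (zeroʳ _))))
      where χ̂≈0 = trans (dft-χ s k) (charSum-≉1 _ θ^[s+k]≉1)

  cmul-scale : ∀ x a g i → cmul p (λ k → x * a k) g i ≈ x * cmul p a g i
  cmul-scale x a g i = trans (sumF-cong p (λ k → *-assoc _ _ _)) (sym (*-distribˡ-sumF p x _))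

  cmul-+ : ∀ a b g i → cmul p (λ k → a k + b k) g i ≈ cmul p a g i + cmul p b g i
  cmul-+ a b g i = trans (sumF-cong p (λ k → distribʳ _ _ _)) (sumF-distrib-+ p _ _)

  cmul-zero : ∀ g i → cmul p (λ _ → 0#) g i ≈ 0#
  cmul-zero g i = sumF-zero p (λ k → zeroˡ _)

  module Cyclic (g : Word p) where
    C : Code p
    C = CyclicCode p g

    C-resp : ∀ {v w} → (∀ i → w i ≈ v i) → C v → C w
    C-resp w≈v (a , v≈ag) = a , (λ i → trans (w≈v i) (v≈ag i))

    C-scale : ∀ x {v} → C v → C (λ i → x * v i)
    C-scale x (a , v≈ag) = (λ k → x * a k) , (λ i → trans (*-congˡ (v≈ag i)) (sym (cmul-scale x a g i)))

    C-+ : ∀ {u v} → C u → C v → C (λ i → u i + v i)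
    C-+ (a , u≈ag) (b , v≈bg) = (λ k → a k + b k) , (λ i → trans (+-cong (u≈ag i) (v≈bg i)) (sym (cmul-+ a b g i)))

    C-zero : C (λ _ → 0#)
    C-zero = (λ _ → 0#) , (λ i → sym (cmul-zero g i))

    C-sumF : ∀ n (w : Fin n → Word p) → (∀ s → C (w s)) → C (λ i → sumF n (λ s → w s i))
    C-sumF zero    w w∈C = C-zero
    C-sumF (suc n) w w∈C = C-+ (w∈C Fin.zero) (C-sumF n (λ s → w (Fin.suc s)) (λ s → w∈C (Fin.suc s)))

    C-root : ∀ {v s} → C v → dft g s ≈ 0# → dft v s ≈ 0#
    C-root {v} {s} (a , v≈ag) ĝ≈0 = begin
      dft v s               ≈⟨ dft-congˡ v≈ag s ⟩
      dft (cmul p a g) s    ≈⟨ dft-cmul a g s ⟩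
      dft a s * dft g s     ≈⟨ *-congˡ ĝ≈0 ⟩
      dft a s * 0#          ≈⟨ zeroʳ _ ⟩
      0#                    ∎

    χ∈C : ∀ s → dft g (neg s) ≉0 → C (χ s)
    χ∈C s ĝ≉0 = (λ k → inv _ ĝ≉0 * χ s k) , (λ i → sym (begin
      cmul p (λ k → inv _ ĝ≉0 * χ s k) g i     ≈⟨ cmul-scale _ (χ s) g i ⟩
      inv _ ĝ≉0 * cmul p (χ s) g i            ≈⟨ *-congˡ (cmul-χ g s i) ⟩
      inv _ ĝ≉0 * (dft g (neg s) * χ s i)     ≈⟨ *-assoc _ _ _ ⟨
      (inv _ ĝ≉0 * dft g (neg s)) * χ s i     ≈⟨ *-congʳ (inverseˡ _ ĝ≉0) ⟩
      1# * χ s i                              ≈⟨ *-identityˡ _ ⟩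
      χ s i                                   ∎))

    -- Pairing v with the codeword cmul (χ s) g = ĝ(θ^(-s)) · χ s reads off ĝ(θ^(-s)) · v̂(θ^s).
    dual-dft-root : ∀ {v} → Dual p C v → ∀ s → dft g (neg s) ≉0 → dft v s ≈ 0#
    dual-dft-root {v} v⊥C s ĝ≉0 = *-zero-cancelˡ ĝ≉0 (begin
      dft g (neg s) * dft v s                ≈⟨ dft-scale _ v s ⟨
      dft (λ i → dft g (neg s) * v i) s      ≈⟨ sumF-cong p (λ i → trans (*-congʳ (*-comm _ _))
                                                   (trans (*-assoc _ _ _) (*-congˡ (sym (cmul-χ g s i))))) ⟩
      inner p v (cmul p (χ s) g)             ≈⟨ v⊥C _ (χ s , (λ i → refl)) ⟩
      0#                                     ∎)

module ResidueClasses {c ℓ} (F : CommutativeRing c ℓ) {q} (FF : IsFiniteField F q)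
         (p : ℕ) .{{_ : NonZero p}} (pp : Prime p) (2<p : 2 < p)
         (θ : CommutativeRing.Carrier F) (prim : CodeDefs.PrimitiveRootOfUnity F p θ)
         (m : ℕ) .{{_ : NonZero m}} (t : ℕ) (t≡[p-1]/m : (p ℕ.∸ 1) ℕ./ m ≡ t)
         (r : ℕ) (r^[p-1]%p≡1 : (r ℕ.^ (p ℕ.∸ 1)) ℕ.% p ≡ 1) (j : ℕ) where
  open Fourier F FF p pp θ prim

  open ≡ₚ-Reasoning

  R : ℕ
  R = r ℕ.^ j

  1<p : 1 < p
  1<p = ℕ.<-trans (s≤s (s≤s z≤n)) 2<p

  ∈A₀⁺ : ∀ {k} → 1 ≤ k → k < p → k ℕ.^ t ≡ₚ 1 → k ∈ A₀ p m
  ∈A₀⁺ {suc k} _ 1+k<p 1+k^t≡ₚ1 = ∈-filter⁺ _ (∈-map⁺ suc (∈-upTo⁺ k<p-1))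
      (≡.trans (≡.cong (λ e → (suc k ℕ.^ e) ℕ.% p) t≡[p-1]/m) (≡.trans (≡ₚ⇒%≡ 1+k^t≡ₚ1) (m<n⇒m%n≡m 1<p)))
    where
    k<p-1 : k < p ℕ.∸ 1
    k<p-1 = ≡.subst (suc k ≤_) (ℕ.pred[m∸n]≡m∸[1+n] p 0) (ℕ.suc[m]≤n⇒m≤pred[n] 1+k<p)

  ∈A₀⁻ : ∀ {k} → k ∈ A₀ p m → 1 ≤ k × k < p × k ℕ.^ t ≡ₚ 1
  ∈A₀⁻ k∈A₀ with ∈-filter⁻ _ {xs = map suc (upTo (p ℕ.∸ 1))} k∈A₀
  ... | k∈sucs , k^t%p≡1 with ∈-map⁻ suc k∈sucs
  ... | k , k∈upTo , ≡.refl = s≤s z≤n , 1+k<p ,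
        ≡ₚ-trans (≡ₚ-% _) (≡⇒≡ₚ (≡.trans (≡.cong (λ e → (suc k ℕ.^ e) ℕ.% p) (≡.sym t≡[p-1]/m)) k^t%p≡1))
    where
    1+k<p : suc k < p
    1+k<p = ℕ.m≤pred[n]⇒suc[m]≤n (≡.subst (suc k ≤_) (≡.sym (ℕ.pred[m∸n]≡m∸[1+n] p 0)) (∈-upTo⁻ k∈upTo))

  ∈ₚA⁻ : ∀ {s} → s ∈ₚ A p m r j → ∃ λ k → k ∈ A₀ p m × s ≡ₚ R ℕ.* k
  ∈ₚA⁻ s∈A with find (Any.map⁻ s∈A)
  ... | k , k∈A₀ , s≡Rk%p = k , k∈A₀ , ≡ₚ-trans s≡Rk%p (≡ₚ-sym (≡ₚ-% _))

  ∈ₚA⁺ : ∀ {s k} → k ∈ A₀ p m → s ≡ₚ R ℕ.* k → s ∈ₚ A p m r j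
  ∈ₚA⁺ k∈A₀ s≡Rk = lose (∈-map⁺ (λ k → (R ℕ.* k) ℕ.% p) k∈A₀) (≡ₚ-trans s≡Rk (≡ₚ-% _))

  R∈ₚA : R ∈ₚ A p m r j
  R∈ₚA = ∈ₚA⁺ (∈A₀⁺ (s≤s z≤n) 1<p (≡⇒≡ₚ (ℕ.^-zeroˡ t))) (≡⇒≡ₚ (≡.sym (ℕ.*-identityʳ R)))

  p-k≡ₚneg[k] : ∀ {k} → k ≤ p → p ℕ.∸ k ≡ₚ neg k
  p-k≡ₚneg[k] {k} k≤p = ≡ₚ-+-cancelʳ k (begin
    p ℕ.∸ k ℕ.+ k      ≡⟨ ℕ.m∸n+n≡m k≤p ⟩
    p                  ≈⟨ p≡ₚ0 ⟩
    0                  ≈⟨ s+neg[s]≡ₚ0 k ⟨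
    k ℕ.+ neg k        ≡⟨ ℕ.+-comm k (neg k) ⟩
    neg k ℕ.+ k        ∎)

  neg-* : ∀ a b → neg (a ℕ.* b) ≡ a ℕ.* neg b
  neg-* a b = solve 3 (λ x a b → x :* (a :* b) := a :* (x :* b)) ≡.refl (p ℕ.∸ 1) a b

  neg[k]^t≡ₚ[p-1]^t : ∀ {k} → k ℕ.^ t ≡ₚ 1 → neg k ℕ.^ t ≡ₚ (p ℕ.∸ 1) ℕ.^ t
  neg[k]^t≡ₚ[p-1]^t {k} k^t≡1 = begin
    neg k ℕ.^ t                       ≡⟨ [m*n]^o≡m^o*n^o (p ℕ.∸ 1) k t ⟩
    (p ℕ.∸ 1) ℕ.^ t ℕ.* k ℕ.^ t       ≈⟨ ≡ₚ-*ˡ ((p ℕ.∸ 1) ℕ.^ t) k^t≡1 ⟩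
    (p ℕ.∸ 1) ℕ.^ t ℕ.* 1             ≡⟨ ℕ.*-identityʳ _ ⟩
    (p ℕ.∸ 1) ℕ.^ t                   ∎

  [p-1]^[2u]≡ₚ1 : ∀ u → (p ℕ.∸ 1) ℕ.^ (2 ℕ.* u) ≡ₚ 1
  [p-1]^[2u]≡ₚ1 u = begin
    (p ℕ.∸ 1) ℕ.^ (2 ℕ.* u)       ≡⟨ ℕ.^-*-assoc (p ℕ.∸ 1) 2 u ⟨
    neg (neg 1) ℕ.^ u             ≈⟨ ≡ₚ-^ u (neg-involutive 1) ⟩
    1 ℕ.^ u                       ≡⟨ ℕ.^-zeroˡ u ⟩
    1                             ∎

  R^[p-2]*R≡ₚ1 : R ℕ.^ (p ℕ.∸ 2) ℕ.* R ≡ₚ 1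
  R^[p-2]*R≡ₚ1 = begin
    R ℕ.^ (p ℕ.∸ 2) ℕ.* R            ≡⟨ ≡.cong (R ℕ.^ (p ℕ.∸ 2) ℕ.*_) (≡.sym (ℕ.^-identityʳ R)) ⟩
    R ℕ.^ (p ℕ.∸ 2) ℕ.* R ℕ.^ 1      ≡⟨ ℕ.^-distribˡ-+-* R (p ℕ.∸ 2) 1 ⟨
    R ℕ.^ (p ℕ.∸ 2 ℕ.+ 1)            ≡⟨ ≡.cong (R ℕ.^_) p-2+1≡p-1 ⟩
    R ℕ.^ (p ℕ.∸ 1)                  ≡⟨ ℕ.^-*-assoc r j (p ℕ.∸ 1) ⟩
    r ℕ.^ (j ℕ.* (p ℕ.∸ 1))          ≡⟨ ≡.cong (r ℕ.^_) (ℕ.*-comm j (p ℕ.∸ 1)) ⟩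
    r ℕ.^ ((p ℕ.∸ 1) ℕ.* j)          ≡⟨ ℕ.^-*-assoc r (p ℕ.∸ 1) j ⟨
    (r ℕ.^ (p ℕ.∸ 1)) ℕ.^ j          ≈⟨ ≡ₚ-^ j (≡ₚ-trans (≡ₚ-% _) (≡⇒≡ₚ r^[p-1]%p≡1)) ⟩
    1 ℕ.^ j                          ≡⟨ ℕ.^-zeroˡ j ⟩
    1                                ∎
    where
    p-2+1≡p-1 : p ℕ.∸ 2 ℕ.+ 1 ≡ p ℕ.∸ 1
    p-2+1≡p-1 = ≡.sym (≡.trans (≡.cong (ℕ._∸ 1) (≡.sym (ℕ.m∸n+n≡m (ℕ.<⇒≤ 2<p)))) (ℕ.+-∸-assoc (p ℕ.∸ 2) (s≤s z≤n)))

  R*-cancel : ∀ {x y} → R ℕ.* x ≡ₚ R ℕ.* y → x ≡ₚ y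
  R*-cancel {x} {y} Rx≡Ry = begin
    x                          ≡⟨ ℕ.*-identityˡ x ⟨
    1 ℕ.* x                    ≈⟨ ≡ₚ-*ʳ x R^[p-2]*R≡ₚ1 ⟨
    R^[p-2] ℕ.* R ℕ.* x        ≡⟨ ℕ.*-assoc R^[p-2] R x ⟩
    R^[p-2] ℕ.* (R ℕ.* x)      ≈⟨ ≡ₚ-*ˡ R^[p-2] Rx≡Ry ⟩
    R^[p-2] ℕ.* (R ℕ.* y)      ≡⟨ ℕ.*-assoc R^[p-2] R y ⟨
    R^[p-2] ℕ.* R ℕ.* y        ≈⟨ ≡ₚ-*ʳ y R^[p-2]*R≡ₚ1 ⟩
    1 ℕ.* y                    ≡⟨ ℕ.*-identityˡ y ⟩
    y                          ∎
    where R^[p-2] = R ℕ.^ (p ℕ.∸ 2)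

  -- For even t, (p - 1)^t ≡ 1, so k ∈ A₀ implies p - k ∈ A₀.
  neg-∈ₚA-even : ∀ {s} → Even t → s ∈ₚ A p m r j → neg s ∈ₚ A p m r j
  neg-∈ₚA-even {s} (u , t≡2u) s∈A with ∈ₚA⁻ s∈A
  ... | k , k∈A₀ , s≡Rk with ∈A₀⁻ k∈A₀
  ... | 1≤k , k<p , k^t≡1 = ∈ₚA⁺ (∈A₀⁺ (ℕ.m<n⇒0<n∸m k<p) (ℕ.∸-monoʳ-< 1≤k (ℕ.<⇒≤ k<p)) [p-k]^t≡1) (begin
      neg s                  ≈⟨ ≡ₚ-*ˡ (p ℕ.∸ 1) s≡Rk ⟩
      neg (R ℕ.* k)          ≡⟨ neg-* R k ⟩
      R ℕ.* neg k            ≈⟨ ≡ₚ-*ˡ R (p-k≡ₚneg[k] (ℕ.<⇒≤ k<p)) ⟨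
      R ℕ.* (p ℕ.∸ k)        ∎)
    where
    [p-k]^t≡1 : (p ℕ.∸ k) ℕ.^ t ≡ₚ 1
    [p-k]^t≡1 = begin
      (p ℕ.∸ k) ℕ.^ t          ≈⟨ ≡ₚ-^ t (p-k≡ₚneg[k] (ℕ.<⇒≤ k<p)) ⟩
      neg k ℕ.^ t              ≈⟨ neg[k]^t≡ₚ[p-1]^t k^t≡1 ⟩
      (p ℕ.∸ 1) ℕ.^ t          ≡⟨ ≡.cong ((p ℕ.∸ 1) ℕ.^_) t≡2u ⟩
      (p ℕ.∸ 1) ℕ.^ (2 ℕ.* u)  ≈⟨ [p-1]^[2u]≡ₚ1 u ⟩
      1                        ∎

  -- For odd t, s and -s both in A_j would give k, k′ ∈ A₀ with k′ ≡ -k, hence 1 ≡ (-1)^t ≡ -1 and p ∣ 2.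
  neg-∉ₚA-odd : ∀ {s} → Odd t → s ∈ₚ A p m r j → ¬ neg s ∈ₚ A p m r j
  neg-∉ₚA-odd {s} (u , t≡1+2u) s∈A neg[s]∈A with ∈ₚA⁻ s∈A | ∈ₚA⁻ neg[s]∈A
  ... | k , k∈A₀ , s≡Rk | k′ , k′∈A₀ , neg[s]≡Rk′ with ∈A₀⁻ k∈A₀ | ∈A₀⁻ k′∈A₀
  ... | _ , _ , k^t≡1 | _ , _ , k′^t≡1 = proj₂ prim 2 (s≤s z≤n) 2<p (θ^≈ 2≡ₚ0)
    where
    k′≡ₚneg[k] : k′ ≡ₚ neg k
    k′≡ₚneg[k] = R*-cancel (begin
      R ℕ.* k′            ≈⟨ neg[s]≡Rk′ ⟨
      neg s               ≈⟨ ≡ₚ-*ˡ (p ℕ.∸ 1) s≡Rk ⟩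
      neg (R ℕ.* k)       ≡⟨ neg-* R k ⟩
      R ℕ.* neg k         ∎)
    1≡ₚp-1 : 1 ≡ₚ p ℕ.∸ 1
    1≡ₚp-1 = begin
      1                                        ≈⟨ k′^t≡1 ⟨
      k′ ℕ.^ t                                 ≈⟨ ≡ₚ-^ t k′≡ₚneg[k] ⟩
      neg k ℕ.^ t                              ≈⟨ neg[k]^t≡ₚ[p-1]^t k^t≡1 ⟩
      (p ℕ.∸ 1) ℕ.^ t                          ≡⟨ ≡.cong ((p ℕ.∸ 1) ℕ.^_) t≡1+2u ⟩
      (p ℕ.∸ 1) ℕ.* (p ℕ.∸ 1) ℕ.^ (2 ℕ.* u)    ≈⟨ ≡ₚ-*ˡ (p ℕ.∸ 1) ([p-1]^[2u]≡ₚ1 u) ⟩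
      (p ℕ.∸ 1) ℕ.* 1                          ≡⟨ ℕ.*-identityʳ _ ⟩
      p ℕ.∸ 1                                  ∎
    2≡ₚ0 : 2 ≡ₚ 0
    2≡ₚ0 = begin
      2                  ≈⟨ ≡ₚ-+ 1≡ₚp-1 (≡ₚ-refl {1}) ⟩
      p ℕ.∸ 1 ℕ.+ 1      ≡⟨ ℕ.m∸n+n≡m (ℕ.<⇒≤ 1<p) ⟩
      p                  ≈⟨ p≡ₚ0 ⟩
      0                  ∎

module ResidueCodes {c ℓ} (F : CommutativeRing c ℓ) {q} (FF : IsFiniteField F q)
         (p : ℕ) .{{_ : NonZero p}} (pp : Prime p) (2<p : 2 < p)
         (θ : CommutativeRing.Carrier F) (prim : CodeDefs.PrimitiveRootOfUnity F p θ)
         (m : ℕ) .{{_ : NonZero m}} (t : ℕ) (t≡[p-1]/m : (p ℕ.∸ 1) ℕ./ m ≡ t)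
         (r : ℕ) (r^[p-1]%p≡1 : (r ℕ.^ (p ℕ.∸ 1)) ℕ.% p ≡ 1) (j : ℕ) where
  open CommutativeRing F
  open CodeDefs F
  open RingLemmas F
  open FieldLemmas F FF
  open Fourier F FF p pp θ prim
  open ResidueClasses F FF p pp 2<p θ prim m t t≡[p-1]/m r r^[p-1]%p≡1 j
  open Cyclic (generator (A p m r j))
  open import Relation.Binary.Reasoning.Setoid setoid

  χ[R]∈Dual : Dual p C (χ R)
  χ[R]∈Dual u u∈C = trans (sumF-cong p (λ i → *-comm _ _)) (C-root u∈C (dft-generator-root R∈ₚA))

  -- For even t, A_j = -A_j: each s is a root of g or -s is not, so v̂ vanishes everywhere.
  LCD-if-even : Even t → IsLCD p C
  LCD-if-even t-even v v∈C v∈Dual = dft-injective (λ s → trans (v̂≈0 s) (sym (sumF-zero p (λ i → zeroˡ _))))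
    where
    v̂≈0 : ∀ s → dft v s ≈ 0#
    v̂≈0 s with s ∈ₚ? A p m r j
    ... | yes s∈A = C-root v∈C (dft-generator-root s∈A)
    ... | no  s∉A = dual-dft-root v∈Dual s (dft-generator-≉0
                      (λ neg[s]∈A → s∉A (∈ₚ-resp-≡ₚ (neg-involutive s) (neg-∈ₚA-even t-even neg[s]∈A))))

  ¬LCD-if-odd : Odd t → ¬ IsLCD p C
  ¬LCD-if-odd t-odd lcd = χ-≉0 R (lcd (χ R) (χ∈C R (dft-generator-≉0 (neg-∉ₚA-odd t-odd R∈ₚA))) χ[R]∈Dual)

  -- By inversion v is a combination of the χ (neg s) with coefficients v̂(θ^s); for s ∈ A_j the
  -- coefficient vanishes since v ⊥ C, and otherwise χ (neg s) ∈ C.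
  SO-if-odd : Odd t → IsSelfOrthogonal p C
  SO-if-odd t-odd v v∈Dual = C-resp v≈ (C-scale (inv (p · 1#) p·1≉0) (C-sumF p W W∈C))
    where
    W : Fin p → Word p
    W s i = dft v (toℕ s) * χ (neg (toℕ i)) s
    W≈ : ∀ s i → W s i ≈ dft v (toℕ s) * χ (neg (toℕ s)) i
    W≈ s i = *-congˡ (reflexive (≡.cong θ^_
      (solve 3 (λ s i n → s :* (n :* i) := i :* (n :* s)) ≡.refl (toℕ s) (toℕ i) (p ℕ.∸ 1))))
    W∈C : ∀ s → C (W s)
    W∈C s with toℕ s ∈ₚ? A p m r j
    ... | yes s∈A = C-resp (λ i → trans (*-congʳ v̂≈0) (zeroˡ _)) C-zero
      where v̂≈0 = dual-dft-root v∈Dual (toℕ s) (dft-generator-≉0 (neg-∉ₚA-odd t-odd s∈A))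
    ... | no  s∉A = C-resp (W≈ s) (C-scale (dft v (toℕ s)) (χ∈C (neg (toℕ s))
                      (dft-generator-≉0 (λ neg²[s]∈A → s∉A (∈ₚ-resp-≡ₚ (neg-involutive (toℕ s)) neg²[s]∈A)))))
    p⁻¹ = inv (p · 1#) p·1≉0
    v≈ : ∀ i → v i ≈ p⁻¹ * sumF p (λ s → W s i)
    v≈ i = *-cancelˡ p·1≉0 (begin
      p · 1# * v i                            ≈⟨ dft-inversion v i ⟨
      sumF p (λ s → W s i)                    ≈⟨ *-identityˡ _ ⟨
      1# * sumF p (λ s → W s i)               ≈⟨ *-congʳ (inverseʳ (p · 1#) p·1≉0) ⟨
      (p · 1# * p⁻¹) * sumF p (λ s → W s i)   ≈⟨ *-assoc _ _ _ ⟩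
      p · 1# * (p⁻¹ * sumF p (λ s → W s i))   ∎)

  ¬SO-if-even : Even t → ¬ IsSelfOrthogonal p C
  ¬SO-if-even t-even so = p·1≉0 (begin
    p · 1#                  ≈⟨ charSum-≈1 _ (θ^≈ (s+neg[s]≡ₚ0 R)) ⟨
    charSum (R ℕ.+ neg R)   ≈⟨ dft-χ R (neg R) ⟨
    dft (χ R) (neg R)       ≈⟨ C-root (so (χ R) χ[R]∈Dual) (dft-generator-root (neg-∈ₚA-even t-even R∈ₚA)) ⟩
    0#                      ∎)

classify : ∀ {a b} {J : Set} → J → {P Q : J → Set a} {X Y : Set b} →
  ((∀ j → P j) × X × ¬ Y × (∀ j → ¬ Q j)) ⊎ ((∀ j → ¬ P j) × ¬ X × Y × (∀ j → Q j)) →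
  ((∃ P) ⇔ X) × ((∀ j → ¬ P j) ⊎ (∀ j → P j)) × ((∃ Q) ⇔ Y) × ((∀ j → ¬ Q j) ⊎ (∀ j → Q j))
classify j₀ (inj₁ (P , X , ¬Y , ¬Q)) =
  mk⇔ (λ _ → X) (λ _ → j₀ , P j₀) , inj₂ P , mk⇔ (λ (j , Qj) → ⊥-elim (¬Q j Qj)) (λ Y → ⊥-elim (¬Y Y)) , inj₁ ¬Q
classify j₀ (inj₂ (¬P , ¬X , Y , Q)) =
  mk⇔ (λ (j , Pj) → ⊥-elim (¬P j Pj)) (λ X → ⊥-elim (¬X X)) , inj₁ ¬P , mk⇔ (λ _ → Y) (λ _ → j₀ , Q j₀) , inj₂ Q

open import Data.Nat using (_∸_; _+_; _*_)

theorem3p3 : ∀ {c ℓ} (F : CommutativeRing c ℓ) (q : ℕ) → IsFiniteField F q → PrimePower q →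
    (p : ℕ) .{{_ : NonZero p}} → Prime p → p ≢ 2 →
    (m : ℕ) .{{_ : NonZero m}} → 2 ≤ m → m ∣ p ∸ 1 →
    p ∣ q ∸ 1 →
    (θ : CommutativeRing.Carrier F) → CodeDefs.PrimitiveRootOfUnity F p θ →
    (r : ℕ) → PrimitiveRootMod p r →
    let open CodeDefs F
        C : Fin m → Code p
        C j = ResidueCode p m r θ (toℕ j)
    in ((∃[ j ] IsLCD p (C j)) ⇔ (2 * m ∣ p ∸ 1))
       × ((∀ j → ¬ IsLCD p (C j)) ⊎ (∀ j → IsLCD p (C j)))
       × ((∃[ j ] IsSelfOrthogonal p (C j)) ⇔ (2 * m ∣ p ∸ (m + 1)))
       × ((∀ j → ¬ IsSelfOrthogonal p (C j)) ⊎ (∀ j → IsSelfOrthogonal p (C j)))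
theorem3p3 F q FF _ p pp p≢2 m _ (divides t p∸1≡tm) _ θ prim r (r^[p-1]%p≡1 , _) =
  classify (fromℕ< (ℕ.>-nonZero⁻¹ m)) (⊎-map even odd (even⊎odd t))
  where
  1<p = ℕ.nonTrivial⇒n>1 p {{prime⇒nonTrivial pp}}
  2<p = ℕ.≤∧≢⇒< 1<p (p≢2 ∘ ≡.sym)
  t≡[p-1]/m = ≡.trans (≡.cong (ℕ._/ m) p∸1≡tm) (m*n/n≡m t m)
  module C (j : Fin m) = ResidueCodes F FF p pp 2<p θ prim m t t≡[p-1]/m r r^[p-1]%p≡1 (toℕ j)
  open QuotientParity p m t 1<p p∸1≡tm
  even = λ t-even → let 2m∣p-1 , 2m∤p-m-1 = even-divisibility t-even in
    (λ j → C.LCD-if-even j t-even) , 2m∣p-1 , 2m∤p-m-1 , (λ j → C.¬SO-if-even j t-even)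
  odd = λ t-odd → let 2m∤p-1 , 2m∣p-m-1 = odd-divisibility t-odd in
    (λ j → C.¬LCD-if-odd j t-odd) , 2m∤p-1 , 2m∣p-m-1 , (λ j → C.SO-if-odd j t-odd)
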